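{- Let $n$ be a positive integer, and let $l\ge2$ and $r\ge1$ be integers with $l\mid n$ and $r<n/l$. If $F_{\mathrm{inv}}$ over $\mathbb F_{2^n}$ is not $r$th order sum-free, then $F_{\mathrm{inv}}$ over $\mathbb F_{2^n}$ is not $(l+r)$th order sum-free.
   Context: $F_{\mathrm{inv}}:\mathbb F_{2^n}\to\mathbb F_{2^n}$ is defined by $F_{\mathrm{inv}}(x)=x^{2^n-2}$ (so $F_{\mathrm{inv}}(x)=x^{ -1}$ for $x\ne0$ and $F_{\mathrm{inv}}(0)=0$). For an integer $1\le k\le n-1$, a function $F:\mathbb F_{2^n}\to\mathbb F_{2^n}$ is called $k$th order sum-free if $\sum_{x\in A}F(x)\ne 0$ for every $k$-dimensional affine $\mathbb F_2$-subspace $A$ of $\mathbb F_{2^n}$. -}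

module Defs where

open import Level using (0ℓ)
open import Data.Nat using (ℕ; zero; suc; _∸_; _^_)
open import Data.Fin using (Fin; zero; suc)
open import Data.Bool using (Bool; true; false; if_then_else_)
open import Data.Product using (∃)
open import Data.Vec.Functional using (_∷_)
open import Algebra.Bundles using (CommutativeRing)
open import Relation.Binary.PropositionalEquality using (_≡_)
open import Relation.Nullary using (¬_)
open import Function.Bundles using (_↔_)

-- A finite field with exactly 2^n elements (the field 𝔽_{2^n}, unique up
-- to isomorphism).
record FiniteField2^ (n : ℕ) : Set₁ where
  field
    commRing : CommutativeRing 0ℓ 0ℓ
  open CommutativeRing commRing public
  field
    ≈⇒≡        : ∀ {x y} → x ≈ y → x ≡ y
    0≢1        : ¬ (0# ≡ 1#)
    inverse    : ∀ x → ¬ (x ≡ 0#) → ∃ λ y → x * y ≡ 1#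
    cardinality : Carrier ↔ Fin (2 ^ n)

module _ {n : ℕ} (K : FiniteField2^ n) where
  open FiniteField2^ K using (Carrier; _+_; _*_; 0#; 1#)

  pow : Carrier → ℕ → Carrier
  pow x zero    = 1#
  pow x (suc m) = x * pow x m

  Finv : Carrier → Carrier
  Finv x = pow x (2 ^ n ∸ 2)

  -- scalar multiplication by an element of 𝔽₂ = Bool
  _·_ : Bool → Carrier → Carrier
  b · v = if b then v else 0#

  lin : ∀ {k} → (Fin k → Bool) → (Fin k → Carrier) → Carrier
  lin {zero}  c v = 0#
  lin {suc k} c v = (c zero · v zero) + lin (λ i → c (suc i)) (λ i → v (suc i))

  sumCube : ∀ k → ((Fin k → Bool) → Carrier) → Carrier
  sumCube zero    f = f (λ ())
  sumCube (suc k) f = sumCube k (λ c → f (false ∷ c)) + sumCube k (λ c → f (true ∷ c))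

  Independent : ∀ {k} → (Fin k → Carrier) → Set
  Independent {k} v = ∀ (c : Fin k → Bool) → lin c v ≡ 0# → ∀ i → c i ≡ false

  affineSum : (Carrier → Carrier) → ∀ k → Carrier → (Fin k → Carrier) → Carrier
  affineSum F k a v = sumCube k (λ c → F (a + lin c v))

  SumFree : ℕ → (Carrier → Carrier) → Set
  SumFree k F = ∀ (a : Carrier) (v : Fin k → Carrier) → Independent v → ¬ (affineSum F k a v ≡ 0#)

module Submission where

-- Let E = 𝔽_{2^l} ⊆ 𝔽_{2^n}. For a subspace V with subspace polynomial L_V(y) = ∏_{v ∈ V} (y + v), one has
-- ∑_{v ∈ V} (y + v)⁻¹ · L_V(y) = D_V ≠ 0 whenever y ∉ V; as E is closed under inversion, its inverses sum to 0,
-- so ∑_{e ∈ E} (y + e)⁻¹ = D_E · L_E(y)⁻¹ for all y. By the first identity, a zero-sum r-dimensional affine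
-- subspace a + V of F_inv is linear (a ∈ V). The image of the additive map L_E has codimension l and rl < n, so some
-- c ≠ 0 satisfies c V ⊆ L_E(K), say c vᵢ = L_E(uᵢ). Then E ⊕ span(u) has dimension l + r, and with
-- L_E(a′) = c a the sum of inverses over a′ + E + span(u) collapses to D_E c⁻¹ ∑_{x ∈ a + V} x⁻¹ = 0.

open import Defs
open import Level using (0ℓ)
open import Data.Nat using (ℕ; zero; suc; _≤_; _<_; z≤n; s≤s)
import Data.Nat as ℕ
import Data.Nat.Properties as ℕ
open import Data.Fin using (Fin; zero; suc; _↑ˡ_; _↑ʳ_; splitAt)
import Data.Fin.Properties as Fin
open import Data.Bool using (Bool; true; false)
open import Data.Product using (∃; ∃-syntax; _×_; _,_; proj₁; proj₂)
open import Data.Sum using (_⊎_; inj₁; inj₂)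
open import Data.Empty using (⊥; ⊥-elim)
open import Relation.Nullary using (¬_; Dec; yes; no; contradiction)
open import Relation.Nullary.Decidable using (map′; decidable-stable; ¬?; _×-dec_)
open import Relation.Unary using (Pred; Decidable; U)
open import Relation.Unary.Properties using (U?; _∩?_)
open import Relation.Binary.Definitions using (DecidableEquality; tri<; tri≈; tri>)
open import Relation.Binary.PropositionalEquality
  using (_≡_; _≢_; refl; sym; trans; cong; cong₂; subst; isEquivalence; module ≡-Reasoning)
open import Function using (_∘_)
open import Function.Bundles using (Inverse; _↔_; mk↔ₛ′)
open import Function.Construct.Composition using (_↔-∘_)
open import Function.Construct.Symmetry using (↔-sym)
open import Algebra.Bundles using (CommutativeMonoid; Semiring; CommutativeRing)
open import Data.Vec.Functional using (_∷_; _++_)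

2^-injective : ∀ {j k} → 2 ℕ.^ j ≡ 2 ℕ.^ k → j ≡ k
2^-injective {j} {k} 2ʲ≡2ᵏ with ℕ.<-cmp j k
... | tri< j<k _ _ = contradiction 2ʲ≡2ᵏ (ℕ.<⇒≢ (ℕ.^-monoʳ-< 2 (s≤s (s≤s z≤n)) j<k))
... | tri≈ _ j≡k _ = j≡k
... | tri> _ _ k<j = contradiction (sym 2ʲ≡2ᵏ) (ℕ.<⇒≢ (ℕ.^-monoʳ-< 2 (s≤s (s≤s z≤n)) k<j))

module Enumerated {X : Set} {N : ℕ} (card : X ↔ Fin N) where
  open Inverse card using (to; from; strictlyInverseˡ; strictlyInverseʳ)

  to-injective : ∀ {x y} → to x ≡ to y → x ≡ y
  to-injective {x} {y} e = trans (sym (strictlyInverseʳ x)) (trans (cong from e) (strictlyInverseʳ y))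

  infix 4 _≟_
  _≟_ : DecidableEquality X
  x ≟ y = map′ to-injective (cong to) (to x Fin.≟ to y)

  any? : ∀ {p} {P : Pred X p} → Decidable P → Dec (∃ P)
  any? {P = P} P? = map′ (λ (i , p) → from i , p)
                         (λ (x , p) → to x , subst P (sym (strictlyInverseʳ x)) p)
                         (Fin.any? (P? ∘ from))

  module Sum {c ℓ} (M : CommutativeMonoid c ℓ) where
    open CommutativeMonoid M
      using (Carrier; rawMonoid; _≈_; _∙_; ε; setoid; ∙-congˡ; ∙-congʳ; identityˡ; identityʳ)
      renaming (trans to ≈-trans; reflexive to ≈-reflexive)
    open import Algebra.Properties.CommutativeMonoid.Sum M
      using (sum; sum-cong-≋; sum-replicate; sum-replicate-zero; sum-permute; ∑-distrib-+; ∑-comm)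
    open import Algebra.Definitions.RawMonoid rawMonoid public using () renaming (_×_ to _×ℕ_)
    open import Relation.Binary.Reasoning.Setoid setoid

    ∑ : (X → Carrier) → Carrier
    ∑ f = sum (f ∘ from)

    ∑-cong : ∀ {f g : X → Carrier} → (∀ x → f x ≈ g x) → ∑ f ≈ ∑ g
    ∑-cong f≈g = sum-cong-≋ (f≈g ∘ from)

    ∑-zero : ∀ (f : X → Carrier) → (∀ x → f x ≈ ε) → ∑ f ≈ ε
    ∑-zero f f≈ε = ≈-trans (∑-cong f≈ε) (sum-replicate-zero N)

    ∑-reindex : (σ : X ↔ X) (f : X → Carrier) → ∑ f ≈ ∑ (f ∘ Inverse.to σ)
    ∑-reindex σ f = begin
      sum (f ∘ from)                          ≈⟨ sum-permute (f ∘ from) (card ↔-∘ (σ ↔-∘ ↔-sym card)) ⟩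
      sum (f ∘ from ∘ to ∘ Inverse.to σ ∘ from) ≈⟨ sum-cong-≋ (λ i → ≈-reflexive (cong f (strictlyInverseʳ (Inverse.to σ (from i))))) ⟩
      sum (f ∘ Inverse.to σ ∘ from)           ∎

    ∑-point : (f : X → Carrier) (a : X) → (∀ x → x ≢ a → f x ≈ ε) → ∑ f ≈ f a
    ∑-point f a off-a = ≈-trans (sum-point (f ∘ from) (to a) off) (≈-reflexive (cong f (strictlyInverseʳ a)))
      where
      off : ∀ i → i ≢ to a → f (from i) ≈ ε
      off i i≢a = off-a (from i) (λ e → i≢a (trans (sym (strictlyInverseˡ i)) (cong to e)))
      sum-point : ∀ {m} (g : Fin m → Carrier) (j : Fin m) → (∀ i → i ≢ j → g i ≈ ε) → sum g ≈ g j
      sum-point {suc m} g zero off-j = ≈-trans (∙-congˡ (≈-trans (sum-cong-≋ (λ i → off-j (suc i) λ ())) (sum-replicate-zero m)))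
                                     (identityʳ (g zero))
      sum-point {suc m} g (suc j) off-j = ≈-trans (∙-congʳ (off-j zero λ ()))
        (≈-trans (identityˡ _) (sum-point (g ∘ suc) j (λ i i≢j → off-j (suc i) (i≢j ∘ Fin.suc-injective))))

    ∑-const : ∀ x → ∑ (λ _ → x) ≈ N ×ℕ x
    ∑-const x = sum-replicate N

    ∑-closed : ∀ {p} (P : Carrier → Set p) → P ε → (∀ {x y} → P x → P y → P (x ∙ y)) →
               (f : X → Carrier) → (∀ x → P (f x)) → P (∑ f)
    ∑-closed P Pε P∙ f Pf = closed (f ∘ from) (Pf ∘ from)
      where
      closed : ∀ {m} (g : Fin m → Carrier) → (∀ i → P (g i)) → P (sum g)
      closed {zero}  g Pg = Pε
      closed {suc m} g Pg = P∙ (Pg zero) (closed (g ∘ suc) (Pg ∘ suc))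

    ∑-monotone : ∀ {r} (R : Carrier → Carrier → Set r) → R ε ε →
                 (∀ {a b c d} → R a b → R c d → R (a ∙ c) (b ∙ d)) →
                 (f g : X → Carrier) → (∀ x → R (f x) (g x)) → R (∑ f) (∑ g)
    ∑-monotone R Rε R∙ f g Rfg = monotone (f ∘ from) (g ∘ from) (Rfg ∘ from)
      where
      monotone : ∀ {m} (f′ g′ : Fin m → Carrier) → (∀ i → R (f′ i) (g′ i)) → R (sum f′) (sum g′)
      monotone {zero}  f′ g′ R′ = Rε
      monotone {suc m} f′ g′ R′ = R∙ (R′ zero) (monotone (f′ ∘ suc) (g′ ∘ suc) (R′ ∘ suc))

    ∑-distrib : (f g : X → Carrier) → ∑ (λ x → f x ∙ g x) ≈ ∑ f ∙ ∑ g
    ∑-distrib f g = ∑-distrib-+ (f ∘ from) (g ∘ from)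

    ∑-swap : (f : X → X → Carrier) → ∑ (λ x → ∑ (f x)) ≈ ∑ (λ y → ∑ (λ x → f x y))
    ∑-swap f = ∑-comm (λ i j → f (from i) (from j))

  module SemiringSum {c ℓ} (S : Semiring c ℓ) where
    open Semiring S using (Carrier; _≈_; _*_; +-commutativeMonoid)
    open Sum +-commutativeMonoid public
    open import Algebra.Properties.Semiring.Sum S using (*-distribˡ-sum)

    ∑-*ˡ : ∀ x (f : X → Carrier) → x * ∑ f ≈ ∑ (λ y → x * f y)
    ∑-*ˡ x f = *-distribˡ-sum x (f ∘ from)

module Field {n : ℕ} (K : FiniteField2^ n) where
  open FiniteField2^ K using (Carrier; _+_; _*_; -_; 0#; 1#; ≈⇒≡; 0≢1; inverse; cardinality)
  private module K = FiniteField2^ K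

  -- The ring of K with propositional equality, so that the library's algebraic lemmas produce _≡_.
  ring : CommutativeRing 0ℓ 0ℓ
  ring = record
    { Carrier = Carrier ; _≈_ = _≡_ ; _+_ = _+_ ; _*_ = _*_ ; -_ = -_ ; 0# = 0# ; 1# = 1#
    ; isCommutativeRing = record
      { isRing = record
        { +-isAbelianGroup = record
          { isGroup = record
            { isMonoid = record
              { isSemigroup = record
                { isMagma = record { isEquivalence = isEquivalence ; ∙-cong = cong₂ _+_ }
                ; assoc = λ x y z → ≈⇒≡ (K.+-assoc x y z) }
              ; identity = ≈⇒≡ ∘ K.+-identityˡ , ≈⇒≡ ∘ K.+-identityʳ }
            ; inverse = ≈⇒≡ ∘ K.-‿inverseˡ , ≈⇒≡ ∘ K.-‿inverseʳ
            ; ⁻¹-cong = cong -_ }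
          ; comm = λ x y → ≈⇒≡ (K.+-comm x y) }
        ; *-cong = cong₂ _*_
        ; *-assoc = λ x y z → ≈⇒≡ (K.*-assoc x y z)
        ; *-identity = ≈⇒≡ ∘ K.*-identityˡ , ≈⇒≡ ∘ K.*-identityʳ
        ; distrib = (λ x y z → ≈⇒≡ (K.distribˡ x y z)) , (λ x y z → ≈⇒≡ (K.distribʳ x y z)) }
      ; *-comm = λ x y → ≈⇒≡ (K.*-comm x y) } }

  open CommutativeRing ring public
    using ( +-assoc; +-comm; +-identityˡ; +-identityʳ; -‿inverseˡ; -‿inverseʳ
          ; *-assoc; *-comm; *-identityˡ; *-identityʳ; distribˡ; distribʳ; zeroˡ; zeroʳ
          ; +-commutativeMonoid; *-commutativeMonoid; semiring; commutativeSemiring; +-group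
          ; +-commutativeSemigroup; *-commutativeSemigroup )
  open import Algebra.Properties.Semiring.Mult semiring public using (×-homo-1; ×1-homo-*; ×-assoc-*)
  open import Algebra.Properties.Semiring.Exp semiring public using (_^_; ^-assocʳ)
  open import Algebra.Properties.CommutativeSemiring.Exp commutativeSemiring public using (^-distrib-*)
  open import Algebra.Properties.CommutativeSemigroup +-commutativeSemigroup public
    using () renaming (interchange to +-interchange)
  open import Algebra.Properties.CommutativeSemigroup *-commutativeSemigroup public
    using () renaming (x∙yz≈y∙xz to *-leftComm)
  open Enumerated cardinality public using (_≟_; any?)
  open Enumerated.SemiringSum cardinality semiring public
  module ∏ = Enumerated.Sum cardinality *-commutativeMonoid

  N : ℕ
  N = 2 ℕ.^ n

  translation : Carrier → Carrier ↔ Carrier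
  translation a = mk↔ₛ′ (a +_) (- a +_) (λ x → +-inverse-cancel a x (-‿inverseʳ a)) (λ x → +-inverse-cancel (- a) x (-‿inverseˡ a))
    where
    +-inverse-cancel : ∀ a x {b} → a + b ≡ 0# → a + (b + x) ≡ x
    +-inverse-cancel a x {b} a+b≡0 = trans (sym (+-assoc a b x)) (trans (cong (_+ x) a+b≡0) (+-identityˡ x))

  ∑-translate : ∀ a (f : Carrier → Carrier) → ∑ f ≡ ∑ (λ x → f (a + x))
  ∑-translate a = ∑-reindex (translation a)

  *-cancelˡ : ∀ {x y z} → x ≢ 0# → x * y ≡ x * z → y ≡ z
  *-cancelˡ {x} {y} {z} x≢0 xy≡xz with inverse x x≢0
  ... | x⁻¹ , xx⁻¹≡1 = begin
    y              ≡⟨ sym (*-identityˡ y) ⟩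
    1# * y         ≡⟨ cong (_* y) (trans (sym xx⁻¹≡1) (*-comm x x⁻¹)) ⟩
    (x⁻¹ * x) * y  ≡⟨ *-assoc x⁻¹ x y ⟩
    x⁻¹ * (x * y)  ≡⟨ cong (x⁻¹ *_) xy≡xz ⟩
    x⁻¹ * (x * z)  ≡⟨ sym (*-assoc x⁻¹ x z) ⟩
    (x⁻¹ * x) * z  ≡⟨ cong (_* z) (trans (*-comm x⁻¹ x) xx⁻¹≡1) ⟩
    1# * z         ≡⟨ *-identityˡ z ⟩
    z              ∎
    where open ≡-Reasoning

  x*y≡0⇒x≡0⊎y≡0 : ∀ {x y} → x * y ≡ 0# → x ≡ 0# ⊎ y ≡ 0#
  x*y≡0⇒x≡0⊎y≡0 {x} {y} xy≡0 with x ≟ 0#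
  ... | yes x≡0 = inj₁ x≡0
  ... | no  x≢0 = inj₂ (*-cancelˡ x≢0 (trans xy≡0 (sym (zeroʳ x))))

  *-nonzero : ∀ {x y} → x ≢ 0# → y ≢ 0# → x * y ≢ 0#
  *-nonzero x≢0 y≢0 xy≡0 with x*y≡0⇒x≡0⊎y≡0 xy≡0
  ... | inj₁ x≡0 = x≢0 x≡0
  ... | inj₂ y≡0 = y≢0 y≡0

  ^-nonzero : ∀ {x} k → x ≢ 0# → x ^ k ≢ 0#
  ^-nonzero zero    x≢0 = 0≢1 ∘ sym
  ^-nonzero (suc k) x≢0 = *-nonzero x≢0 (^-nonzero k x≢0)

  -- Characteristic two, Frobenius and Fermat

  open import Algebra.Properties.Group +-group using (identityˡ-unique)

  ^≡0⇒≡0 : ∀ {x} k → x ^ k ≡ 0# → x ≡ 0#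
  ^≡0⇒≡0 {x} k xᵏ≡0 with x ≟ 0#
  ... | yes x≡0 = x≡0
  ... | no  x≢0 = contradiction xᵏ≡0 (^-nonzero k x≢0)

  N×x≡0 : ∀ x → N ×ℕ x ≡ 0#
  N×x≡0 x = identityˡ-unique (N ×ℕ x) (∑ (λ y → y)) (begin
    N ×ℕ x + ∑ (λ y → y)            ≡⟨ cong (_+ ∑ (λ y → y)) (sym (∑-const x)) ⟩
    ∑ (λ _ → x) + ∑ (λ y → y)      ≡⟨ sym (∑-distrib (λ _ → x) (λ y → y)) ⟩
    ∑ (λ y → x + y)                ≡⟨ sym (∑-translate x (λ y → y)) ⟩
    ∑ (λ y → y)                    ∎)
    where open ≡-Reasoning

  2ᵏ×1≡[2×1]ᵏ : ∀ k → (2 ℕ.^ k) ×ℕ 1# ≡ (2 ×ℕ 1#) ^ k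
  2ᵏ×1≡[2×1]ᵏ zero    = ×-homo-1 1#
  2ᵏ×1≡[2×1]ᵏ (suc k) = trans (×1-homo-* 2 (2 ℕ.^ k)) (cong (2 ×ℕ 1# *_) (2ᵏ×1≡[2×1]ᵏ k))

  x+x≡0 : ∀ x → x + x ≡ 0#
  x+x≡0 x = begin
    x + x              ≡⟨ cong (x +_) (sym (+-identityʳ x)) ⟩
    2 ×ℕ x              ≡⟨ cong (2 ×ℕ_) (sym (*-identityˡ x)) ⟩
    2 ×ℕ (1# * x)       ≡⟨ sym (×-assoc-* 2 1# x) ⟩
    (2 ×ℕ 1#) * x       ≡⟨ cong (_* x) 2×1≡0 ⟩
    0# * x             ≡⟨ zeroˡ x ⟩
    0#                 ∎
    where
    open ≡-Reasoning
    2×1≡0 : 2 ×ℕ 1# ≡ 0#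
    2×1≡0 = ^≡0⇒≡0 n (trans (sym (2ᵏ×1≡[2×1]ᵏ n)) (N×x≡0 1#))

  x+[x+y]≡y : ∀ x y → x + (x + y) ≡ y
  x+[x+y]≡y x y = trans (sym (+-assoc x x y)) (trans (cong (_+ y) (x+x≡0 x)) (+-identityˡ y))

  [x+y]+y≡x : ∀ x y → (x + y) + y ≡ x
  [x+y]+y≡x x y = trans (+-assoc x y y) (trans (cong (x +_) (x+x≡0 y)) (+-identityʳ x))

  x+y≡0⇒x≡y : ∀ {x y} → x + y ≡ 0# → x ≡ y
  x+y≡0⇒x≡y {x} {y} x+y≡0 = trans (sym ([x+y]+y≡x x y)) (trans (cong (_+ y) x+y≡0) (+-identityˡ y))

  [x+y]*[x+y]≡x*x+y*y : ∀ x y → (x + y) * (x + y) ≡ x * x + y * y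
  [x+y]*[x+y]≡x*x+y*y x y = begin
    (x + y) * (x + y)                      ≡⟨ distribʳ (x + y) x y ⟩
    x * (x + y) + y * (x + y)              ≡⟨ cong₂ _+_ (distribˡ x x y) (distribˡ y x y) ⟩
    (x * x + x * y) + (y * x + y * y)      ≡⟨ cong (λ t → (x * x + x * y) + (t + y * y)) (*-comm y x) ⟩
    (x * x + x * y) + (x * y + y * y)      ≡⟨ +-assoc (x * x) (x * y) (x * y + y * y) ⟩
    x * x + (x * y + (x * y + y * y))      ≡⟨ cong (x * x +_) (x+[x+y]≡y (x * y) (y * y)) ⟩
    x * x + y * y                          ∎
    where open ≡-Reasoning

  +-square : ∀ x y → (x + y) ^ 2 ≡ x ^ 2 + y ^ 2
  +-square x y = trans (cong ((x + y) *_) (*-identityʳ (x + y)))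
    (trans ([x+y]*[x+y]≡x*x+y*y x y) (sym (cong₂ _+_ (cong (x *_) (*-identityʳ x)) (cong (y *_) (*-identityʳ y)))))

  frobenius : ℕ → Carrier → Carrier
  frobenius k x = x ^ (2 ℕ.^ k)

  frobenius-suc : ∀ k x → frobenius (suc k) x ≡ frobenius k x ^ 2
  frobenius-suc k x = trans (cong (x ^_) (ℕ.*-comm 2 (2 ℕ.^ k))) (sym (^-assocʳ x (2 ℕ.^ k) 2))

  frobenius-+ : ∀ k x y → frobenius k (x + y) ≡ frobenius k x + frobenius k y
  frobenius-+ zero    x y = distribʳ 1# x y
  frobenius-+ (suc k) x y = begin
    frobenius (suc k) (x + y)                        ≡⟨ frobenius-suc k (x + y) ⟩
    frobenius k (x + y) ^ 2                          ≡⟨ cong (_^ 2) (frobenius-+ k x y) ⟩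
    (frobenius k x + frobenius k y) ^ 2              ≡⟨ +-square (frobenius k x) (frobenius k y) ⟩
    frobenius k x ^ 2 + frobenius k y ^ 2            ≡⟨ sym (cong₂ _+_ (frobenius-suc k x) (frobenius-suc k y)) ⟩
    frobenius (suc k) x + frobenius (suc k) y        ∎
    where open ≡-Reasoning

  frobenius-0# : ∀ k → frobenius k 0# ≡ 0#
  frobenius-0# zero    = zeroˡ 1#
  frobenius-0# (suc k) = trans (frobenius-suc k 0#) (trans (cong (_^ 2) (frobenius-0# k)) (zeroˡ _))

  frobenius-∘ : ∀ j k x → frobenius j (frobenius k x) ≡ frobenius (j ℕ.+ k) x
  frobenius-∘ j k x = trans (^-assocʳ x (2 ℕ.^ k) (2 ℕ.^ j))
    (cong (x ^_) (trans (ℕ.*-comm (2 ℕ.^ k) (2 ℕ.^ j)) (sym (ℕ.^-distribˡ-+-* 2 j k))))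

  frobenius-^ : ∀ k x m → frobenius k (x ^ m) ≡ frobenius k x ^ m
  frobenius-^ k x m = trans (^-assocʳ x m (2 ℕ.^ k))
    (trans (cong (x ^_) (ℕ.*-comm m (2 ℕ.^ k))) (sym (^-assocʳ x (2 ℕ.^ k) m)))

  scaling : ∀ x → x ≢ 0# → Carrier ↔ Carrier
  scaling x x≢0 with inverse x x≢0
  ... | x⁻¹ , xx⁻¹≡1 = mk↔ₛ′ (x *_) (x⁻¹ *_) (cancel xx⁻¹≡1) (cancel (trans (*-comm x⁻¹ x) xx⁻¹≡1))
    where
    cancel : ∀ {a b} → a * b ≡ 1# → ∀ y → a * (b * y) ≡ y
    cancel {a} {b} ab≡1 y = trans (sym (*-assoc a b y)) (trans (cong (_* y) ab≡1) (*-identityˡ y))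

  1+[N∸1]≡N : suc (N ℕ.∸ 1) ≡ N
  1+[N∸1]≡N = ℕ.m+[n∸m]≡n (ℕ.m^n>0 2 n)

  private
    -- ∏ unit is the product of the nonzero elements of K.
    unit : Carrier → Carrier
    unit y with y ≟ 0#
    ... | yes _ = 1#
    ... | no  _ = y

    unit-0# : unit 0# ≡ 1#
    unit-0# with 0# ≟ 0#
    ... | yes _   = refl
    ... | no  0≢0 = contradiction refl 0≢0

    unit-nonzero : ∀ {y} → y ≢ 0# → unit y ≡ y
    unit-nonzero {y} y≢0 with y ≟ 0#
    ... | yes y≡0 = contradiction y≡0 y≢0
    ... | no  _   = refl

    unit≢0 : ∀ y → unit y ≢ 0#
    unit≢0 y with y ≟ 0#
    ... | yes _   = 0≢1 ∘ sym
    ... | no  y≢0 = y≢0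

    ∏-unit≢0 : ∏.∑ unit ≢ 0#
    ∏-unit≢0 = ∏.∑-closed (_≢ 0#) (0≢1 ∘ sym) *-nonzero unit unit≢0

    ∏-scaled-unit : ∀ {x} → x ≢ 0# → ∏.∑ (λ y → x * unit y) ≡ x * ∏.∑ unit
    ∏-scaled-unit {x} x≢0 = begin
      ∏.∑ (λ y → x * unit y)                       ≡⟨ ∏.∑-cong scaled-unit ⟩
      ∏.∑ (λ y → x-at-0# y * unit (x * y))         ≡⟨ ∏.∑-distrib x-at-0# (λ y → unit (x * y)) ⟩
      ∏.∑ x-at-0# * ∏.∑ (λ y → unit (x * y))       ≡⟨ cong₂ _*_ (trans (∏.∑-point x-at-0# 0# x-at-y≢0) x-at-0#≡x)
                                                                (sym (∏.∑-reindex (scaling x x≢0) unit)) ⟩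
      x * ∏.∑ unit                                 ∎
      where
      open ≡-Reasoning
      x-at-0# : Carrier → Carrier
      x-at-0# y with y ≟ 0#
      ... | yes _ = x
      ... | no  _ = 1#
      x-at-0#≡x : x-at-0# 0# ≡ x
      x-at-0#≡x with 0# ≟ 0#
      ... | yes _   = refl
      ... | no  0≢0 = contradiction refl 0≢0
      x-at-y≢0 : ∀ y → y ≢ 0# → x-at-0# y ≡ 1#
      x-at-y≢0 y y≢0 with y ≟ 0#
      ... | yes y≡0 = contradiction y≡0 y≢0
      ... | no  _   = refl
      scaled-unit : ∀ y → x * unit y ≡ x-at-0# y * unit (x * y)
      scaled-unit y with y ≟ 0#
      ... | yes refl = cong (x *_) (sym (trans (cong unit (zeroʳ x)) unit-0#))
      ... | no  y≢0  = sym (trans (*-identityˡ _) (unit-nonzero (*-nonzero x≢0 y≢0)))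

  x^N≡x : ∀ x → x ^ N ≡ x
  x^N≡x x with x ≟ 0#
  ... | yes refl = trans (cong (0# ^_) (sym 1+[N∸1]≡N)) (zeroˡ _)
  ... | no  x≢0  = *-cancelˡ ∏-unit≢0 (begin
    P * x ^ N                  ≡⟨ *-comm P (x ^ N) ⟩
    x ^ N * P                  ≡⟨ cong (_* P) (sym (∏.∑-const x)) ⟩
    ∏.∑ (λ _ → x) * P          ≡⟨ sym (∏.∑-distrib (λ _ → x) unit) ⟩
    ∏.∑ (λ y → x * unit y)     ≡⟨ ∏-scaled-unit x≢0 ⟩
    x * P                      ≡⟨ *-comm x P ⟩
    P * x                      ∎)
    where
    open ≡-Reasoning
    P = ∏.∑ unit

  x^[N∸1]≡1 : ∀ {x} → x ≢ 0# → x ^ (N ℕ.∸ 1) ≡ 1#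
  x^[N∸1]≡1 {x} x≢0 = *-cancelˡ x≢0
    (trans (cong (x ^_) 1+[N∸1]≡N) (trans (x^N≡x x) (sym (*-identityʳ x))))

  frobenius-n : ∀ x → frobenius n x ≡ x
  frobenius-n = x^N≡x

  -- Counting

  𝟙 : ∀ {a} {A : Set a} → Dec A → ℕ
  𝟙 (yes _) = 1
  𝟙 (no  _) = 0

  module # = Enumerated.SemiringSum cardinality ℕ.+-*-semiring

  count : ∀ {p} {P : Pred Carrier p} → Decidable P → ℕ
  count P? = #.∑ (λ x → 𝟙 (P? x))

  module _ {p q r} {P : Pred Carrier p} {Q : Pred Carrier q} {R : Pred Carrier r}
           (P? : Decidable P) (Q? : Decidable Q) (R? : Decidable R) where

    count-∪ : (∀ {x} → P x → Q x ⊎ R x) → count P? ≤ count Q? ℕ.+ count R?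
    count-∪ P⊆Q∪R = ℕ.≤-trans (#.∑-monotone _≤_ z≤n ℕ.+-mono-≤ _ _ (λ x → 𝟙-∪ (P? x) (Q? x) (R? x)))
                              (ℕ.≤-reflexive (#.∑-distrib (λ x → 𝟙 (Q? x)) (λ x → 𝟙 (R? x))))
      where
      𝟙-∪ : ∀ {x} → (a : Dec (P x)) (b : Dec (Q x)) (c : Dec (R x)) → 𝟙 a ≤ 𝟙 b ℕ.+ 𝟙 c
      𝟙-∪ (no _)  _       _       = z≤n
      𝟙-∪ (yes _) (yes _) _       = s≤s z≤n
      𝟙-∪ (yes _) (no _)  (yes _) = s≤s z≤n
      𝟙-∪ (yes p) (no ¬q) (no ¬r) with P⊆Q∪R p
      ... | inj₁ q = contradiction q ¬q
      ... | inj₂ r = contradiction r ¬r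

    count-disjoint-∪ : (∀ {x} → P x → Q x ⊎ R x) → (∀ {x} → Q x → P x) → (∀ {x} → R x → P x) →
                       (∀ {x} → Q x → R x → ⊥) → count P? ≡ count Q? ℕ.+ count R?
    count-disjoint-∪ P⊆Q∪R Q⊆P R⊆P Q∩R=∅ =
      trans (#.∑-cong (λ x → 𝟙-disjoint (P? x) (Q? x) (R? x))) (#.∑-distrib (λ x → 𝟙 (Q? x)) (λ x → 𝟙 (R? x)))
      where
      𝟙-disjoint : ∀ {x} → (a : Dec (P x)) (b : Dec (Q x)) (c : Dec (R x)) → 𝟙 a ≡ 𝟙 b ℕ.+ 𝟙 c
      𝟙-disjoint _       (yes q) (yes r) = ⊥-elim (Q∩R=∅ q r)
      𝟙-disjoint (yes _) (yes _) (no _)  = refl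
      𝟙-disjoint (yes _) (no _)  (yes _) = refl
      𝟙-disjoint (yes p) (no ¬q) (no ¬r) with P⊆Q∪R p
      ... | inj₁ q = contradiction q ¬q
      ... | inj₂ r = contradiction r ¬r
      𝟙-disjoint (no ¬p) (yes q) (no _)  = contradiction (Q⊆P q) ¬p
      𝟙-disjoint (no ¬p) (no _)  (yes r) = contradiction (R⊆P r) ¬p
      𝟙-disjoint (no _)  (no _)  (no _)  = refl

  module _ {p q} {P : Pred Carrier p} {Q : Pred Carrier q} (P? : Decidable P) (Q? : Decidable Q) where

    count-mono : (∀ {x} → P x → Q x) → count P? ≤ count Q?
    count-mono P⊆Q = #.∑-monotone _≤_ z≤n ℕ.+-mono-≤ _ _ (λ x → 𝟙-mono (P? x) (Q? x))
      where
      𝟙-mono : ∀ {x} → (a : Dec (P x)) (b : Dec (Q x)) → 𝟙 a ≤ 𝟙 b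
      𝟙-mono (no _)  _      = z≤n
      𝟙-mono (yes _) (yes _) = s≤s z≤n
      𝟙-mono (yes p) (no ¬q) = contradiction (P⊆Q p) ¬q

  count-cong : ∀ {p q} {P : Pred Carrier p} {Q : Pred Carrier q} (P? : Decidable P) (Q? : Decidable Q) →
               (∀ {x} → P x → Q x) → (∀ {x} → Q x → P x) → count P? ≡ count Q?
  count-cong P? Q? P⊆Q Q⊆P = ℕ.≤-antisym (count-mono P? Q? P⊆Q) (count-mono Q? P? Q⊆P)

  count-U : count U? ≡ N
  count-U = trans (#.∑-const 1) (N×1≡N N)
    where
    N×1≡N : ∀ m → m #.×ℕ 1 ≡ m
    N×1≡N zero    = refl
    N×1≡N (suc m) = cong suc (N×1≡N m)

  count≤N : ∀ {p} {P : Pred Carrier p} (P? : Decidable P) → count P? ≤ N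
  count≤N P? = ℕ.≤-trans (count-mono P? U? _) (ℕ.≤-reflexive count-U)

  count-∅ : ∀ {p} {P : Pred Carrier p} (P? : Decidable P) → (∀ x → ¬ P x) → count P? ≡ 0
  count-∅ P? P=∅ = #.∑-zero _ 𝟙-∅
    where
    𝟙-∅ : ∀ x → 𝟙 (P? x) ≡ 0
    𝟙-∅ x with P? x
    ... | yes p = contradiction p (P=∅ x)
    ... | no  _ = refl

  count-unique : ∀ {p} {P : Pred Carrier p} (P? : Decidable P) a → P a → (∀ {x} → P x → x ≡ a) → count P? ≡ 1
  count-unique P? a Pa unique = trans (#.∑-point _ a 𝟙-off-a) 𝟙-a
    where
    𝟙-off-a : ∀ x → x ≢ a → 𝟙 (P? x) ≡ 0
    𝟙-off-a x x≢a with P? x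
    ... | yes Px = contradiction (unique Px) x≢a
    ... | no  _  = refl
    𝟙-a : 𝟙 (P? a) ≡ 1
    𝟙-a with P? a
    ... | yes _   = refl
    ... | no  ¬Pa = contradiction Pa ¬Pa

  count-translate : ∀ {p} {P : Pred Carrier p} (P? : Decidable P) a → count P? ≡ count (λ x → P? (a + x))
  count-translate P? a = #.∑-reindex (translation a) (λ x → 𝟙 (P? x))

  count≢0⇒∃ : ∀ {p} {P : Pred Carrier p} (P? : Decidable P) → count P? ≢ 0 → ∃ P
  count≢0⇒∃ P? count≢0 with any? P?
  ... | yes ∃P = ∃P
  ... | no  ∄P = contradiction (count-∅ P? (λ x Px → ∄P (x , Px))) count≢0

  record IsSubgroup {p} (A : Pred Carrier p) : Set p where
    field
      0#-closed : A 0#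
      +-closed  : ∀ {x y} → A x → A y → A (x + y)

  U-isSubgroup : IsSubgroup U
  U-isSubgroup = record { 0#-closed = _ ; +-closed = _ }

  Additive : (Carrier → Carrier) → Set
  Additive f = ∀ x y → f (x + y) ≡ f x + f y

  additive-0# : ∀ {f} → Additive f → f 0# ≡ 0#
  additive-0# {f} f+ = identityˡ-unique (f 0#) (f 0#) (trans (sym (f+ 0# 0#)) (cong f (+-identityˡ 0#)))

  Image : ∀ {p} → Pred Carrier p → (Carrier → Carrier) → Pred Carrier p
  Image A f y = ∃[ x ] (A x × f x ≡ y)

  image? : ∀ {p} {A : Pred Carrier p} → Decidable A → ∀ f → Decidable (Image A f)
  image? A? f y = any? (λ x → A? x ×-dec (f x ≟ y))

  count-fibre : ∀ {p} {A : Pred Carrier p} (A? : Decidable A) → IsSubgroup A → ∀ {f} → Additive f →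
                ∀ {x₀ y} → A x₀ → f x₀ ≡ y → count (λ x → A? x ×-dec (f x ≟ y)) ≡ count (A? ∩? λ x → f x ≟ 0#)
  count-fibre {A = A} A? A-subgroup {f} f+ {x₀} {y} Ax₀ fx₀≡y =
    trans (count-translate (λ x → A? x ×-dec (f x ≟ y)) x₀)
          (count-cong (λ x → A? (x₀ + x) ×-dec (f (x₀ + x) ≟ y)) (A? ∩? λ x → f x ≟ 0#) to-kernel from-kernel)
    where
    open IsSubgroup A-subgroup
    open import Algebra.Properties.Group +-group using (identityʳ-unique)
    f[x₀+x] : ∀ x → f (x₀ + x) ≡ y + f x
    f[x₀+x] x = trans (f+ x₀ x) (cong (_+ f x) fx₀≡y)
    to-kernel : ∀ {x} → A (x₀ + x) × f (x₀ + x) ≡ y → A x × f x ≡ 0#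
    to-kernel {x} (A[x₀+x] , f[x₀+x]≡y) =
      subst A (x+[x+y]≡y x₀ x) (+-closed Ax₀ A[x₀+x]) ,
      identityʳ-unique y (f x) (trans (sym (f[x₀+x] x)) f[x₀+x]≡y)
    from-kernel : ∀ {x} → A x × f x ≡ 0# → A (x₀ + x) × f (x₀ + x) ≡ y
    from-kernel {x} (Ax , fx≡0) = +-closed Ax₀ Ax , trans (f[x₀+x] x) (trans (cong (y +_) fx≡0) (+-identityʳ y))

  rank-nullity : ∀ {p} {A : Pred Carrier p} (A? : Decidable A) → IsSubgroup A → ∀ {f} → Additive f →
                 count A? ≡ count (A? ∩? λ x → f x ≟ 0#) ℕ.* count (image? A? f)
  rank-nullity {A = A} A? A-subgroup {f} f+ = begin
    count A?                                           ≡⟨ #.∑-cong fibre-through-x ⟩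
    #.∑ (λ x → #.∑ (λ y → 𝟙 (A? x ×-dec (f x ≟ y))))   ≡⟨ #.∑-swap (λ x y → 𝟙 (A? x ×-dec (f x ≟ y))) ⟩
    #.∑ (λ y → count (λ x → A? x ×-dec (f x ≟ y)))     ≡⟨ #.∑-cong fibre-size ⟩
    #.∑ (λ y → κ ℕ.* 𝟙 (image? A? f y))                ≡⟨ sym (#.∑-*ˡ κ (λ y → 𝟙 (image? A? f y))) ⟩
    κ ℕ.* count (image? A? f)                          ∎
    where
    open ≡-Reasoning

    κ : ℕ
    κ = count (A? ∩? λ x → f x ≟ 0#)

    fibre-through-x : ∀ x → 𝟙 (A? x) ≡ count (λ y → A? x ×-dec (f x ≟ y))
    fibre-through-x x = 𝟙-cases (A? x)
      where
      𝟙-cases : (a : Dec (A x)) → 𝟙 a ≡ count (λ y → A? x ×-dec (f x ≟ y))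
      𝟙-cases (yes Ax) = sym (count-unique (λ y → A? x ×-dec (f x ≟ y)) (f x) (Ax , refl) (sym ∘ proj₂))
      𝟙-cases (no ¬Ax) = sym (count-∅ (λ y → A? x ×-dec (f x ≟ y)) (λ _ → ¬Ax ∘ proj₁))

    fibre-size : ∀ y → count (λ x → A? x ×-dec (f x ≟ y)) ≡ κ ℕ.* 𝟙 (image? A? f y)
    fibre-size y with image? A? f y
    ... | yes (x₀ , Ax₀ , fx₀≡y) = trans (count-fibre A? A-subgroup f+ Ax₀ fx₀≡y) (sym (ℕ.*-identityʳ κ))
    ... | no  y∉f[A]             = trans (count-∅ (λ x → A? x ×-dec (f x ≟ y)) (λ x (Ax , fx≡y) → y∉f[A] (x , Ax , fx≡y)))
                                         (sym (ℕ.*-zeroʳ κ))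

  -- Polynomial functions and the root bound

  [c+x]+[c+y]≡x+y : ∀ c x y → (c + x) + (c + y) ≡ x + y
  [c+x]+[c+y]≡x+y c x y = trans (+-interchange c x c y) (trans (cong (_+ (x + y)) (x+x≡0 c)) (+-identityˡ (x + y)))

  xp+aq≡[x+a]p+a[p+q] : ∀ x a p q → x * p + a * q ≡ (x + a) * p + a * (p + q)
  xp+aq≡[x+a]p+a[p+q] x a p q = sym (begin
    (x + a) * p + a * (p + q)            ≡⟨ cong₂ _+_ (distribʳ p x a) (distribˡ a p q) ⟩
    (x * p + a * p) + (a * p + a * q)    ≡⟨ +-assoc (x * p) (a * p) (a * p + a * q) ⟩
    x * p + (a * p + (a * p + a * q))    ≡⟨ cong (x * p +_) (x+[x+y]≡y (a * p) (a * q)) ⟩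
    x * p + a * q                        ∎)
    where open ≡-Reasoning

  -- Poly< d f: f is a polynomial function of degree < d, presented in Horner form f x = c + x * g x.
  Poly< : ℕ → (Carrier → Carrier) → Set
  Poly< zero    f = ∀ x → f x ≡ 0#
  Poly< (suc d) f = ∃[ c ] ∃[ g ] (Poly< d g × (∀ x → f x ≡ c + x * g x))

  Monic : ℕ → (Carrier → Carrier) → Set
  Monic d f = ∃[ g ] (Poly< d g × (∀ x → f x ≡ x ^ d + g x))

  Poly<-cong : ∀ {d f g} → (∀ x → f x ≡ g x) → Poly< d f → Poly< d g
  Poly<-cong {zero}  f≗g f≗0 x = trans (sym (f≗g x)) (f≗0 x)
  Poly<-cong {suc d} f≗g (c , h , h<d , f≗) = c , h , h<d , (λ x → trans (sym (f≗g x)) (f≗ x))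

  Poly<-0 : ∀ d → Poly< d (λ _ → 0#)
  Poly<-0 zero    x = refl
  Poly<-0 (suc d) = 0# , (λ _ → 0#) , Poly<-0 d , (λ x → sym (trans (+-identityˡ _) (zeroʳ x)))

  Poly<-suc : ∀ {d f} → Poly< d f → Poly< (suc d) f
  Poly<-suc {zero}  f≗0 = 0# , (λ _ → 0#) , (λ _ → refl) , (λ x → trans (f≗0 x) (sym (trans (+-identityˡ _) (zeroʳ x))))
  Poly<-suc {suc d} (c , g , g<d , f≗) = c , g , Poly<-suc g<d , f≗

  Poly<-≤ : ∀ {d e f} → d ≤ e → Poly< d f → Poly< e f
  Poly<-≤ {e = zero}  z≤n     f<0 = f<0
  Poly<-≤ {e = suc e} z≤n     f<0 = Poly<-suc (Poly<-≤ {e = e} z≤n f<0)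
  Poly<-≤ {e = suc e} (s≤s d≤e) (c , g , g<d , f≗) = c , g , Poly<-≤ d≤e g<d , f≗

  Poly<-+ : ∀ {d f g} → Poly< d f → Poly< d g → Poly< d (λ x → f x + g x)
  Poly<-+ {zero}  f≗0 g≗0 x = trans (cong₂ _+_ (f≗0 x) (g≗0 x)) (+-identityˡ 0#)
  Poly<-+ {suc d} (c₁ , g₁ , g₁<d , f≗) (c₂ , g₂ , g₂<d , g≗) =
    c₁ + c₂ , (λ x → g₁ x + g₂ x) , Poly<-+ g₁<d g₂<d ,
    (λ x → trans (cong₂ _+_ (f≗ x) (g≗ x))
             (trans (+-interchange c₁ _ c₂ _) (cong (c₁ + c₂ +_) (sym (distribˡ x _ _)))))

  Poly<-*ˡ : ∀ {d f} a → Poly< d f → Poly< d (λ x → a * f x)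
  Poly<-*ˡ {zero}  a f≗0 x = trans (cong (a *_) (f≗0 x)) (zeroʳ a)
  Poly<-*ˡ {suc d} a (c , g , g<d , f≗) =
    a * c , (λ x → a * g x) , Poly<-*ˡ a g<d ,
    (λ x → trans (cong (a *_) (f≗ x)) (trans (distribˡ a c _) (cong (a * c +_) (*-leftComm a x _))))

  Poly<-^ : ∀ {k d} → k < d → Poly< d (_^ k)
  Poly<-^ {zero}  {suc d} _ = 1# , (λ _ → 0#) , Poly<-0 d , (λ x → sym (trans (cong (1# +_) (zeroʳ x)) (+-identityʳ 1#)))
  Poly<-^ {suc k} {suc d} (s≤s k<d) = 0# , (_^ k) , Poly<-^ k<d , (λ x → sym (+-identityˡ _))

  Monic⇒Poly< : ∀ {d f} → Monic d f → Poly< (suc d) f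
  Monic⇒Poly< {d} (g , g<d , f≗) = Poly<-cong (λ x → sym (f≗ x)) (Poly<-+ (Poly<-^ ℕ.≤-refl) (Poly<-suc g<d))

  Poly<-factor : ∀ {d h} → Poly< (suc d) h → ∀ a →
                 ∃[ q ] (Poly< d q × (∀ x → h x + h a ≡ (x + a) * q x))
  Poly<-factor {zero} {h} (c , g , g≗0 , h≗) a = (λ _ → 0#) , (λ _ → refl) , λ x → begin
    h x + h a                      ≡⟨ cong₂ _+_ (h≗ x) (h≗ a) ⟩
    (c + x * g x) + (c + a * g a)  ≡⟨ [c+x]+[c+y]≡x+y c _ _ ⟩
    x * g x + a * g a              ≡⟨ cong₂ _+_ (cong (x *_) (g≗0 x)) (cong (a *_) (g≗0 a)) ⟩
    x * 0# + a * 0#                ≡⟨ trans (cong₂ _+_ (zeroʳ x) (zeroʳ a)) (+-identityˡ 0#) ⟩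
    0#                             ≡⟨ sym (zeroʳ (x + a)) ⟩
    (x + a) * 0#                   ∎
    where open ≡-Reasoning
  Poly<-factor {suc d} {h} (c , g , g<d , h≗) a with Poly<-factor g<d a
  ... | q , q<d , g-factor = (λ x → g x + a * q x) , Poly<-+ g<d (Poly<-suc (Poly<-*ˡ a q<d)) , λ x → begin
    h x + h a                                  ≡⟨ cong₂ _+_ (h≗ x) (h≗ a) ⟩
    (c + x * g x) + (c + a * g a)              ≡⟨ [c+x]+[c+y]≡x+y c _ _ ⟩
    x * g x + a * g a                          ≡⟨ xp+aq≡[x+a]p+a[p+q] x a (g x) (g a) ⟩
    (x + a) * g x + a * (g x + g a)            ≡⟨ cong (λ t → (x + a) * g x + a * t) (g-factor x) ⟩
    (x + a) * g x + a * ((x + a) * q x)        ≡⟨ cong ((x + a) * g x +_) (*-leftComm a (x + a) (q x)) ⟩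
    (x + a) * g x + (x + a) * (a * q x)        ≡⟨ sym (distribˡ (x + a) (g x) (a * q x)) ⟩
    (x + a) * (g x + a * q x)                  ∎
    where open ≡-Reasoning

  ^-factor : ∀ d a → ∃[ q ] (Monic d q × (∀ x → x ^ suc d + a ^ suc d ≡ (x + a) * q x))
  ^-factor zero a = (λ _ → 1#) , ((λ _ → 0#) , (λ _ → refl) , (λ _ → sym (+-identityʳ 1#))) ,
    (λ x → trans (cong₂ _+_ (*-identityʳ x) (*-identityʳ a)) (sym (*-identityʳ (x + a))))
  ^-factor (suc d) a with ^-factor d a
  ... | q , q-monic , ^-factorisation = (λ x → x ^ suc d + a * q x) ,
    ((λ x → a * q x) , Poly<-*ˡ a (Monic⇒Poly< q-monic) , (λ _ → refl)) , λ x → begin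
      x * x ^ suc d + a * a ^ suc d                          ≡⟨ xp+aq≡[x+a]p+a[p+q] x a _ _ ⟩
      (x + a) * x ^ suc d + a * (x ^ suc d + a ^ suc d)      ≡⟨ cong (λ t → (x + a) * x ^ suc d + a * t) (^-factorisation x) ⟩
      (x + a) * x ^ suc d + a * ((x + a) * q x)              ≡⟨ cong ((x + a) * x ^ suc d +_) (*-leftComm a (x + a) (q x)) ⟩
      (x + a) * x ^ suc d + (x + a) * (a * q x)              ≡⟨ sym (distribˡ (x + a) _ _) ⟩
      (x + a) * (x ^ suc d + a * q x)                        ∎
    where open ≡-Reasoning

  Monic-factor : ∀ {d f} → Monic (suc d) f → ∀ a → ∃[ q ] (Monic d q × (∀ x → f x + f a ≡ (x + a) * q x))
  Monic-factor {d} {f} (h , h<d , f≗) a with ^-factor d a | Poly<-factor h<d a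
  ... | Q , (g , g<d , Q≗) , ^-factorisation | q , q<d , h-factor =
    (λ x → Q x + q x) , ((λ x → g x + q x) , Poly<-+ g<d q<d , (λ x → trans (cong (_+ q x) (Q≗ x)) (+-assoc _ _ _))) ,
    λ x → begin
      f x + f a                                          ≡⟨ cong₂ _+_ (f≗ x) (f≗ a) ⟩
      (x ^ suc d + h x) + (a ^ suc d + h a)              ≡⟨ +-interchange _ _ _ _ ⟩
      (x ^ suc d + a ^ suc d) + (h x + h a)              ≡⟨ cong₂ _+_ (^-factorisation x) (h-factor x) ⟩
      (x + a) * Q x + (x + a) * q x                      ≡⟨ sym (distribˡ _ _ _) ⟩
      (x + a) * (Q x + q x)                              ∎
    where open ≡-Reasoning

  root-bound : ∀ d {f} → Monic d f → count (λ x → f x ≟ 0#) ≤ d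
  root-bound zero {f} (g , g≗0 , f≗) = ℕ.≤-reflexive (count-∅ (λ x → f x ≟ 0#) f≢0)
    where
    f≢0 : ∀ x → f x ≢ 0#
    f≢0 x fx≡0 = 0≢1 (trans (sym fx≡0) (trans (f≗ x) (trans (cong (1# +_) (g≗0 x)) (+-identityʳ 1#))))
  root-bound (suc d) {f} f-monic with any? (λ x → f x ≟ 0#)
  ... | no  no-root = ℕ.≤-trans (ℕ.≤-reflexive (count-∅ (λ x → f x ≟ 0#) (λ x fx≡0 → no-root (x , fx≡0)))) z≤n
  ... | yes (a , fa≡0) with Monic-factor f-monic a
  ...   | q , q-monic , f-factor = begin
    count (λ x → f x ≟ 0#)                         ≤⟨ count-∪ (λ x → f x ≟ 0#) (_≟ a) (λ x → q x ≟ 0#) root-a-or-q ⟩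
    count (_≟ a) ℕ.+ count (λ x → q x ≟ 0#)        ≤⟨ ℕ.+-mono-≤ (ℕ.≤-reflexive (count-unique (_≟ a) a refl (λ x≡a → x≡a))) (root-bound d q-monic) ⟩
    suc d                                          ∎
    where
    open ℕ.≤-Reasoning
    root-a-or-q : ∀ {x} → f x ≡ 0# → x ≡ a ⊎ q x ≡ 0#
    root-a-or-q {x} fx≡0 with x*y≡0⇒x≡0⊎y≡0 (trans (sym (f-factor x)) (trans (cong₂ _+_ fx≡0 fa≡0) (+-identityˡ 0#)))
    ... | inj₁ x+a≡0 = inj₁ (x+y≡0⇒x≡y x+a≡0)
    ... | inj₂ qx≡0  = inj₂ qx≡0

  -- Subspace polynomials, independence and bases

  product-additive : ∀ {g} → Additive g → ∀ w → Additive (λ y → g y * g (y + w))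
  product-additive {g} g+ w y z = begin
    g (y + z) * g ((y + z) + w)             ≡⟨ cong₂ _*_ (g+ y z) (trans (g+ (y + z) w) (cong (_+ W) (g+ y z))) ⟩
    (Y + Z) * ((Y + Z) + W)                 ≡⟨ distribˡ (Y + Z) (Y + Z) W ⟩
    (Y + Z) * (Y + Z) + (Y + Z) * W         ≡⟨ cong₂ _+_ ([x+y]*[x+y]≡x*x+y*y Y Z) (distribʳ W Y Z) ⟩
    (Y * Y + Z * Z) + (Y * W + Z * W)       ≡⟨ +-interchange (Y * Y) (Z * Z) (Y * W) (Z * W) ⟩
    (Y * Y + Y * W) + (Z * Z + Z * W)       ≡⟨ sym (cong₂ _+_ (distribˡ Y Y W) (distribˡ Z Z W)) ⟩
    Y * (Y + W) + Z * (Z + W)               ≡⟨ sym (cong₂ _+_ (cong (Y *_) (g+ y w)) (cong (Z *_) (g+ z w))) ⟩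
    Y * g (y + w) + Z * g (z + w)           ∎
    where
    open ≡-Reasoning
    Y = g y
    Z = g z
    W = g w

  -- The subspace polynomial L w y = ∏_{v ∈ span w} (y + v).
  L : ∀ {k} → (Fin k → Carrier) → Carrier → Carrier
  L {zero}  w y = y
  L {suc k} w y = L (w ∘ suc) y * L (w ∘ suc) (y + w zero)

  L-additive : ∀ {k} (w : Fin k → Carrier) → Additive (L w)
  L-additive {zero}  w y z = refl
  L-additive {suc k} w     = product-additive (L-additive (w ∘ suc)) (w zero)

  lin-cong : ∀ {k} (c : Fin k → Bool) {v v′ : Fin k → Carrier} → (∀ i → v i ≡ v′ i) → lin K c v ≡ lin K c v′
  lin-cong {zero}  c v≗v′ = refl
  lin-cong {suc k} c v≗v′ = cong₂ _+_ (cong (_·_ K (c zero)) (v≗v′ zero)) (lin-cong (c ∘ suc) (v≗v′ ∘ suc))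

  lin-additive : ∀ {k f} → Additive f → (c : Fin k → Bool) (v : Fin k → Carrier) → f (lin K c v) ≡ lin K c (f ∘ v)
  lin-additive {zero}  f+ c v = additive-0# f+
  lin-additive {suc k} {f} f+ c v =
    trans (f+ _ _) (cong₂ _+_ (·-additive (c zero)) (lin-additive f+ (c ∘ suc) (v ∘ suc)))
    where
    ·-additive : ∀ b → f (_·_ K b (v zero)) ≡ _·_ K b (f (v zero))
    ·-additive true  = refl
    ·-additive false = additive-0# f+

  lin-*ˡ : ∀ {k} a (c : Fin k → Bool) (v : Fin k → Carrier) → a * lin K c v ≡ lin K c (λ i → a * v i)
  lin-*ˡ a = lin-additive (distribˡ a)

  lin-false : ∀ {k} (c : Fin k → Bool) (v : Fin k → Carrier) → (∀ i → c i ≡ false) → lin K c v ≡ 0#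
  lin-false {zero}  c v c≡false = refl
  lin-false {suc k} c v c≡false rewrite c≡false zero =
    trans (+-identityˡ _) (lin-false (c ∘ suc) (v ∘ suc) (c≡false ∘ suc))

  lin-0 : ∀ {k} (c : Fin k → Bool) {v : Fin k → Carrier} → (∀ i → v i ≡ 0#) → lin K c v ≡ 0#
  lin-0 c {v} v≡0 = trans (lin-cong c (λ i → trans (v≡0 i) (sym (zeroˡ (v i))))) (trans (sym (lin-*ˡ 0# c v)) (zeroˡ _))

  L-lin : ∀ {k} (w : Fin k → Carrier) (c : Fin k → Bool) → L w (lin K c w) ≡ 0#
  L-lin {zero}  w c = refl
  L-lin {suc k} w c with c zero
  ... | false = trans (cong (λ t → L w′ t * L w′ (t + w zero)) (+-identityˡ (lin K (c ∘ suc) w′)))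
                      (trans (cong (_* L w′ (lin K (c ∘ suc) w′ + w zero)) (L-lin w′ (c ∘ suc))) (zeroˡ _))
    where w′ = w ∘ suc
  ... | true  = trans (cong (L w′ (w zero + c∙w′) *_) (cong (L w′) (trans (cong (_+ w zero) (+-comm (w zero) c∙w′)) ([x+y]+y≡x c∙w′ (w zero)))))
                      (trans (cong (L w′ (w zero + c∙w′) *_) (L-lin w′ (c ∘ suc))) (zeroʳ _))
    where w′ = w ∘ suc
          c∙w′ = lin K (c ∘ suc) w′

  L-generator : ∀ {k} (w : Fin k → Carrier) i → L w (w i) ≡ 0#
  L-generator {suc k} w zero    = trans (cong (L (w ∘ suc) (w zero) *_) (trans (cong (L (w ∘ suc)) (x+x≡0 (w zero))) (additive-0# (L-additive (w ∘ suc))))) (zeroʳ _)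
  L-generator {suc k} w (suc i) = trans (cong (_* L (w ∘ suc) (w (suc i) + w zero)) (L-generator (w ∘ suc) i)) (zeroˡ _)

  L≡0⇒∈span : ∀ {k} (w : Fin k → Carrier) {y} → L w y ≡ 0# → ∃[ c ] lin K c w ≡ y
  L≡0⇒∈span {zero}  w Ly≡0 = (λ ()) , sym Ly≡0
  L≡0⇒∈span {suc k} w {y} Ly≡0 with x*y≡0⇒x≡0⊎y≡0 Ly≡0
  ... | inj₁ L′y≡0 with L≡0⇒∈span (w ∘ suc) L′y≡0
  ...   | c , c∙w≡y = (false ∷ c) , trans (+-identityˡ _) c∙w≡y
  L≡0⇒∈span {suc k} w {y} Ly≡0 | inj₂ L′[y+w₀]≡0 with L≡0⇒∈span (w ∘ suc) L′[y+w₀]≡0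
  ...   | c , c∙w≡y+w₀ = (true ∷ c) , trans (cong (w zero +_) c∙w≡y+w₀) (trans (+-comm (w zero) _) ([x+y]+y≡x y (w zero)))

  independent-tail : ∀ {k} {w : Fin (suc k) → Carrier} → Independent K w → Independent K (w ∘ suc)
  independent-tail w-indep c c∙w≡0 i = w-indep (false ∷ c) (trans (+-identityˡ _) c∙w≡0) (suc i)

  independent-head : ∀ {k} {w : Fin (suc k) → Carrier} → Independent K w → L (w ∘ suc) (w zero) ≢ 0#
  independent-head {w = w} w-indep L′w₀≡0 with L≡0⇒∈span (w ∘ suc) L′w₀≡0
  ... | c , c∙w≡w₀ with w-indep (true ∷ c) (trans (cong (w zero +_) c∙w≡w₀) (x+x≡0 (w zero))) zero
  ...   | ()

  independent-∷ : ∀ {k x} {w : Fin k → Carrier} → Independent K w → L w x ≢ 0# → Independent K (x ∷ w)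
  independent-∷ {x = x} {w} w-indep Lx≢0 c c∙[x∷w]≡0 = coefficients (c zero) refl c∙[x∷w]≡0
    where
    coefficients : ∀ b → c zero ≡ b → _·_ K b x + lin K (c ∘ suc) w ≡ 0# → ∀ i → c i ≡ false
    coefficients true  _      x+c∙w≡0 = contradiction (trans (cong (L w) (x+y≡0⇒x≡y x+c∙w≡0)) (L-lin w (c ∘ suc))) Lx≢0
    coefficients false c₀≡f   _       zero    = c₀≡f
    coefficients false _      0+c∙w≡0 (suc i) = w-indep (c ∘ suc) (trans (sym (+-identityˡ _)) 0+c∙w≡0) i

  independent-cong : ∀ {k} {v v′ : Fin k → Carrier} → (∀ i → v i ≡ v′ i) → Independent K v → Independent K v′
  independent-cong v≗v′ v-indep c c∙v′≡0 = v-indep c (trans (lin-cong c v≗v′) c∙v′≡0)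

  independent-*ˡ : ∀ {k} {a} {v : Fin k → Carrier} → a ≢ 0# → Independent K v → Independent K (λ i → a * v i)
  independent-*ˡ {a = a} {v} a≢0 v-indep c c∙av≡0 = v-indep c (*-cancelˡ a≢0 (trans (lin-*ˡ a c v) (trans c∙av≡0 (sym (zeroʳ a)))))

  ++-suc : ∀ {p m} (e : Fin (suc p) → Carrier) (u : Fin m → Carrier) i → (e ++ u) (suc i) ≡ ((e ∘ suc) ++ u) i
  ++-suc {p} e u i with splitAt p i
  ... | inj₁ _ = refl
  ... | inj₂ _ = refl

  lin-++ : ∀ {p m} (γ : Fin (p ℕ.+ m) → Bool) (e : Fin p → Carrier) (u : Fin m → Carrier) →
           lin K γ (e ++ u) ≡ lin K (γ ∘ (_↑ˡ m)) e + lin K (γ ∘ (p ↑ʳ_)) u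
  lin-++ {zero}      γ e u = sym (+-identityˡ _)
  lin-++ {suc p} {m} γ e u = begin
    _·_ K (γ zero) (e zero) + lin K (γ ∘ suc) ((e ++ u) ∘ suc)              ≡⟨ cong (_ +_) (lin-cong (γ ∘ suc) (++-suc e u)) ⟩
    _·_ K (γ zero) (e zero) + lin K (γ ∘ suc) ((e ∘ suc) ++ u)              ≡⟨ cong (_ +_) (lin-++ (γ ∘ suc) (e ∘ suc) u) ⟩
    _·_ K (γ zero) (e zero) + (lin K (γ ∘ suc ∘ (_↑ˡ m)) (e ∘ suc) + lin K (γ ∘ (suc p ↑ʳ_)) u) ≡⟨ sym (+-assoc _ _ _) ⟩
    lin K (γ ∘ (_↑ˡ m)) e + lin K (γ ∘ (suc p ↑ʳ_)) u                       ∎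
    where open ≡-Reasoning

  independent-++ : ∀ {p m} {e : Fin p → Carrier} {u : Fin m → Carrier} {f} → Additive f →
                   Independent K e → (∀ i → f (e i) ≡ 0#) → Independent K (f ∘ u) → Independent K (e ++ u)
  independent-++ {p} {m} {e} {u} {f} f+ e-indep f∘e≡0 f∘u-indep γ γ∙[e++u]≡0 = γ≡false
    where
    α = γ ∘ (_↑ˡ m)
    β = γ ∘ (p ↑ʳ_)
    α∙e+β∙u≡0 : lin K α e + lin K β u ≡ 0#
    α∙e+β∙u≡0 = trans (sym (lin-++ γ e u)) γ∙[e++u]≡0
    β≡false : ∀ j → β j ≡ false
    β≡false = f∘u-indep β (begin
      lin K β (f ∘ u)                        ≡⟨ sym (lin-additive f+ β u) ⟩
      f (lin K β u)                          ≡⟨ sym (+-identityˡ _) ⟩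
      0# + f (lin K β u)                     ≡⟨ cong (_+ f (lin K β u)) (sym (trans (lin-additive f+ α e) (lin-0 α f∘e≡0))) ⟩
      f (lin K α e) + f (lin K β u)          ≡⟨ sym (f+ _ _) ⟩
      f (lin K α e + lin K β u)              ≡⟨ cong f α∙e+β∙u≡0 ⟩
      f 0#                                   ≡⟨ additive-0# f+ ⟩
      0#                                     ∎)
      where open ≡-Reasoning
    α≡false : ∀ j → α j ≡ false
    α≡false = e-indep α (trans (sym (+-identityʳ _)) (trans (cong (lin K α e +_) (sym (lin-false β u β≡false))) α∙e+β∙u≡0))
    γ≡false : ∀ i → γ i ≡ false
    γ≡false i with splitAt p i in split-i
    ... | inj₁ j = trans (cong γ (sym (Fin.splitAt⁻¹-↑ˡ split-i))) (α≡false j)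
    ... | inj₂ j = trans (cong γ (sym (Fin.splitAt⁻¹-↑ʳ split-i))) (β≡false j)

  count-span : ∀ {k} (w : Fin k → Carrier) → Independent K w → count (λ y → L w y ≟ 0#) ≡ 2 ℕ.^ k
  count-span {zero}  w _ = count-unique (_≟ 0#) 0# refl (λ y≡0 → y≡0)
  count-span {suc k} w w-indep = begin
    count (λ y → L w y ≟ 0#)                                 ≡⟨ count-disjoint-∪ (λ y → L w y ≟ 0#) (λ y → L′ y ≟ 0#) (λ y → L′ (y + w₀) ≟ 0#)
                                                                   x*y≡0⇒x≡0⊎y≡0 (λ {y} L′y≡0 → trans (cong (_* L′ (y + w₀)) L′y≡0) (zeroˡ _))
                                                                   (λ {y} L′[y+w₀]≡0 → trans (cong (L′ y *_) L′[y+w₀]≡0) (zeroʳ _)) disjoint ⟩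
    count (λ y → L′ y ≟ 0#) ℕ.+ count (λ y → L′ (y + w₀) ≟ 0#) ≡⟨ cong (count (λ y → L′ y ≟ 0#) ℕ.+_) count-translate′ ⟩
    count (λ y → L′ y ≟ 0#) ℕ.+ count (λ y → L′ y ≟ 0#)        ≡⟨ cong₂ ℕ._+_ IH (trans IH (sym (ℕ.+-identityʳ _))) ⟩
    2 ℕ.^ k ℕ.+ (2 ℕ.^ k ℕ.+ 0)                              ∎
    where
    open ≡-Reasoning
    w₀ = w zero
    L′ = L (w ∘ suc)
    IH = count-span (w ∘ suc) (independent-tail {w = w} w-indep)
    disjoint : ∀ {y} → L′ y ≡ 0# → L′ (y + w₀) ≡ 0# → ⊥
    disjoint {y} L′y≡0 L′[y+w₀]≡0 = independent-head {w = w} w-indep (begin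
      L′ w₀               ≡⟨ cong L′ (sym (x+[x+y]≡y y w₀)) ⟩
      L′ (y + (y + w₀))   ≡⟨ L-additive (w ∘ suc) y (y + w₀) ⟩
      L′ y + L′ (y + w₀)  ≡⟨ cong₂ _+_ L′y≡0 L′[y+w₀]≡0 ⟩
      0# + 0#             ≡⟨ +-identityˡ 0# ⟩
      0#                  ∎)
    count-translate′ : count (λ y → L′ (y + w₀) ≟ 0#) ≡ count (λ y → L′ y ≟ 0#)
    count-translate′ = trans (count-translate (λ y → L′ (y + w₀) ≟ 0#) w₀)
      (count-cong (λ y → L′ ((w₀ + y) + w₀) ≟ 0#) (λ y → L′ y ≟ 0#)
        (λ e → trans (cong L′ (sym (shift _))) e) (λ e → trans (cong L′ (shift _)) e))
      where
      shift : ∀ y → (w₀ + y) + w₀ ≡ y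
      shift y = trans (cong (_+ w₀) (+-comm w₀ y)) ([x+y]+y≡x y w₀)

  lin-closed : ∀ {p} {P : Pred Carrier p} → IsSubgroup P → ∀ {k} {w : Fin k → Carrier} →
               (∀ i → P (w i)) → ∀ c → P (lin K c w)
  lin-closed P-subgroup {zero}  w∈P c = IsSubgroup.0#-closed P-subgroup
  lin-closed {P = P} P-subgroup {suc k} {w} w∈P c = IsSubgroup.+-closed P-subgroup (·-closed (c zero)) (lin-closed P-subgroup (w∈P ∘ suc) (c ∘ suc))
    where
    ·-closed : ∀ b → P (_·_ K b (w zero))
    ·-closed true  = w∈P zero
    ·-closed false = IsSubgroup.0#-closed P-subgroup

  Basis : ∀ {p} → Pred Carrier p → ∀ {k} → (Fin k → Carrier) → Set p
  Basis P w = Independent K w × (∀ {x} → P x → L w x ≡ 0#) × (∀ {x} → L w x ≡ 0# → P x)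

  basis : ∀ {p} {P : Pred Carrier p} → Decidable P → IsSubgroup P → ∃[ k ] ∃[ w ] Basis P {k} w
  basis {P = P} P? P-subgroup = grow (suc n) 0 refl (λ ()) (λ _ _ ()) (λ ())
    where
    grow : ∀ fuel k → k ℕ.+ fuel ≡ suc n → (w : Fin k → Carrier) → Independent K w → (∀ i → P (w i)) →
           ∃[ k ] ∃[ w ] Basis P {k} w
    grow zero k k+0≡1+n w w-indep _ = contradiction (ℕ.^-monoʳ-< 2 (s≤s (s≤s z≤n)) (ℕ.n<1+n n)) (ℕ.≤⇒≯ 2¹⁺ⁿ≤N)
      where
      2¹⁺ⁿ≤N : 2 ℕ.^ suc n ≤ N
      2¹⁺ⁿ≤N = subst (λ m → 2 ℕ.^ m ≤ N) (trans (sym (ℕ.+-identityʳ k)) k+0≡1+n)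
                 (subst (_≤ N) (count-span w w-indep) (count≤N (λ y → L w y ≟ 0#)))
    grow (suc fuel) k k+1+fuel≡1+n w w-indep w∈P with any? (λ x → P? x ×-dec ¬? (L w x ≟ 0#))
    ... | yes (x , Px , Lx≢0) = grow fuel (suc k) (trans (sym (ℕ.+-suc k fuel)) k+1+fuel≡1+n) (x ∷ w)
                                     (independent-∷ w-indep Lx≢0) x∷w∈P
      where
      x∷w∈P : ∀ i → P ((x ∷ w) i)
      x∷w∈P zero    = Px
      x∷w∈P (suc i) = w∈P i
    ... | no  P⊆span = k , w , w-indep , (λ {x} Px → decidable-stable (L w x ≟ 0#) (λ Lx≢0 → P⊆span (x , Px , Lx≢0))) ,
                       (λ Lx≡0 → subst P (proj₂ (L≡0⇒∈span w Lx≡0)) (lin-closed P-subgroup w∈P _))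

  basis-count : ∀ {p} {P : Pred Carrier p} (P? : Decidable P) {k} {w : Fin k → Carrier} → Basis P w → count P? ≡ 2 ℕ.^ k
  basis-count P? {w = w} (w-indep , P⊆span , span⊆P) = trans (count-cong P? (λ y → L w y ≟ 0#) P⊆span span⊆P) (count-span w w-indep)

  image-isSubgroup : ∀ {p} {A : Pred Carrier p} → IsSubgroup A → ∀ {f} → Additive f → IsSubgroup (Image A f)
  image-isSubgroup A-subgroup {f} f+ = record
    { 0#-closed = 0# , 0#-closed , additive-0# f+
    ; +-closed  = λ { (x , Ax , fx≡y) (x′ , Ax′ , fx′≡y′) → x + x′ , +-closed Ax Ax′ , trans (f+ x x′) (cong₂ _+_ fx≡y fx′≡y′) } }
    where open IsSubgroup A-subgroup

  rank-nullity-U : ∀ {f} → Additive f → N ≡ count (λ x → f x ≟ 0#) ℕ.* count (image? U? f)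
  rank-nullity-U {f} f+ = begin
    N                                                      ≡⟨ sym count-U ⟩
    count U?                                               ≡⟨ rank-nullity U? U-isSubgroup f+ ⟩
    count (U? ∩? λ x → f x ≟ 0#) ℕ.* count (image? U? f)   ≡⟨ cong (ℕ._* count (image? U? f)) (count-cong (U? ∩? λ x → f x ≟ 0#) (λ x → f x ≟ 0#) proj₂ (_ ,_)) ⟩
    count (λ x → f x ≟ 0#) ℕ.* count (image? U? f)         ∎
    where open ≡-Reasoning

  cokernel : ∀ {f} → Additive f →
             ∃[ h ] (Additive h × (∀ {y} → h y ≡ 0# → Image U f y) × count (image? U? h) ≡ count (λ x → f x ≟ 0#))
  cokernel {f} f+ with basis (image? U? f) (image-isSubgroup U-isSubgroup f+)
  ... | k , g , g-independent , im⊆span , span⊆im = L g , L-additive g , span⊆im , ℕ.*-cancelˡ-≡ _ _ #im {{#im≢0}} (begin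
    #im ℕ.* count (image? U? (L g))                        ≡⟨ cong (ℕ._* count (image? U? (L g))) (count-cong (image? U? f) (λ y → L g y ≟ 0#) im⊆span span⊆im) ⟩
    count (λ y → L g y ≟ 0#) ℕ.* count (image? U? (L g))   ≡⟨ sym (rank-nullity-U (L-additive g)) ⟩
    N                                                      ≡⟨ rank-nullity-U f+ ⟩
    count (λ x → f x ≟ 0#) ℕ.* #im                         ≡⟨ ℕ.*-comm _ #im ⟩
    #im ℕ.* count (λ x → f x ≟ 0#)                         ∎)
    where
    open ≡-Reasoning
    #im = count (image? U? f)
    #im≢0 : ℕ.NonZero #im
    #im≢0 = ℕ.>-nonZero (ℕ.≤-trans (ℕ.≤-reflexive (sym (count-unique (_≟ 0#) 0# refl (λ x≡0 → x≡0))))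
                                   (count-mono (_≟ 0#) (image? U? f) (λ { refl → 0# , _ , additive-0# f+ })))

  module _ {h : Carrier → Carrier} (h+ : Additive h) where

    Annihilates : ∀ {r} → (Fin r → Carrier) → Pred Carrier 0ℓ
    Annihilates v c = ∀ i → h (c * v i) ≡ 0#

    annihilates? : ∀ {r} (v : Fin r → Carrier) → Decidable (Annihilates v)
    annihilates? v c = Fin.all? (λ i → h (c * v i) ≟ 0#)

    Annihilates-isSubgroup : ∀ {r} (v : Fin r → Carrier) → IsSubgroup (Annihilates v)
    Annihilates-isSubgroup v = record
      { 0#-closed = λ i → trans (cong h (zeroˡ (v i))) (additive-0# h+)
      ; +-closed  = λ {c} {c′} hcv≡0 hc′v≡0 i → trans (cong h (distribʳ (v i) c c′))
                      (trans (h+ _ _) (trans (cong₂ _+_ (hcv≡0 i) (hc′v≡0 i)) (+-identityˡ 0#))) }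

    count-Annihilates : ∀ {d} → count (image? U? h) ≤ 2 ℕ.^ d → ∀ {r} (v : Fin r → Carrier) →
                        N ≤ count (annihilates? v) ℕ.* 2 ℕ.^ (r ℕ.* d)
    count-Annihilates {d} #im≤2ᵈ {zero} v = ℕ.≤-reflexive (trans (sym count-U)
      (trans (count-cong U? (annihilates? v) (λ _ ()) _) (sym (ℕ.*-identityʳ _))))
    count-Annihilates {d} #im≤2ᵈ {suc r} v = begin
      N                                                                  ≤⟨ count-Annihilates #im≤2ᵈ (v ∘ suc) ⟩
      count (annihilates? (v ∘ suc)) ℕ.* 2 ℕ.^ (r ℕ.* d)                 ≡⟨ cong (ℕ._* 2 ℕ.^ (r ℕ.* d)) (rank-nullity (annihilates? (v ∘ suc)) (Annihilates-isSubgroup (v ∘ suc)) (h∘*v₀-additive)) ⟩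
      (#ker ℕ.* count (image? (annihilates? (v ∘ suc)) h∘*v₀)) ℕ.* 2 ℕ.^ (r ℕ.* d)
                                                                         ≤⟨ ℕ.*-monoˡ-≤ (2 ℕ.^ (r ℕ.* d)) (ℕ.*-mono-≤ (ℕ.≤-reflexive kernel≡) (ℕ.≤-trans image≤ #im≤2ᵈ)) ⟩
      (count (annihilates? v) ℕ.* 2 ℕ.^ d) ℕ.* 2 ℕ.^ (r ℕ.* d)           ≡⟨ ℕ.*-assoc (count (annihilates? v)) _ _ ⟩
      count (annihilates? v) ℕ.* (2 ℕ.^ d ℕ.* 2 ℕ.^ (r ℕ.* d))           ≡⟨ cong (count (annihilates? v) ℕ.*_) (sym (ℕ.^-distribˡ-+-* 2 d (r ℕ.* d))) ⟩
      count (annihilates? v) ℕ.* 2 ℕ.^ (suc r ℕ.* d)                     ∎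
      where
      open ℕ.≤-Reasoning
      h∘*v₀ : Carrier → Carrier
      h∘*v₀ c = h (c * v zero)
      h∘*v₀-additive : Additive h∘*v₀
      h∘*v₀-additive c c′ = trans (cong h (distribʳ (v zero) c c′)) (h+ _ _)
      #ker = count (annihilates? (v ∘ suc) ∩? λ c → h∘*v₀ c ≟ 0#)
      kernel≡ : #ker ≡ count (annihilates? v)
      kernel≡ = count-cong (annihilates? (v ∘ suc) ∩? λ c → h∘*v₀ c ≟ 0#) (annihilates? v)
        (λ { (hcv′≡0 , hcv₀≡0) zero → hcv₀≡0 ; (hcv′≡0 , hcv₀≡0) (suc i) → hcv′≡0 i })
        (λ hcv≡0 → hcv≡0 ∘ suc , hcv≡0 zero)
      image≤ : count (image? (annihilates? (v ∘ suc)) h∘*v₀) ≤ count (image? U? h)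
      image≤ = count-mono (image? (annihilates? (v ∘ suc)) h∘*v₀) (image? U? h) (λ { (c , _ , hcv₀≡y) → c * v zero , _ , hcv₀≡y })

    nonzero-annihilator : ∀ {d} → count (image? U? h) ≤ 2 ℕ.^ d → ∀ {r} (v : Fin r → Carrier) → r ℕ.* d < n →
                          ∃[ c ] (c ≢ 0# × Annihilates v c)
    nonzero-annihilator {d} #im≤2ᵈ {r} v rd<n = reorder (count≢0⇒∃ (annihilates? v ∩? λ c → ¬? (c ≟ 0#)) #nonzero≢0)
      where
      reorder : ∃[ c ] (Annihilates v c × c ≢ 0#) → ∃[ c ] (c ≢ 0# × Annihilates v c)
      reorder (c , Ac , c≢0) = c , c≢0 , Ac
      2≤#A : 2 ≤ count (annihilates? v)
      2≤#A = ℕ.≮⇒≥ λ #A<2 → ℕ.<⇒≱ (ℕ.^-monoʳ-< 2 (s≤s (s≤s z≤n)) rd<n)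
        (ℕ.≤-trans (count-Annihilates #im≤2ᵈ v) (ℕ.≤-trans (ℕ.*-monoˡ-≤ _ (ℕ.≤-pred #A<2)) (ℕ.≤-reflexive (ℕ.+-identityʳ _))))
      #A≤#nonzero+1 : count (annihilates? v) ≤ count (annihilates? v ∩? λ c → ¬? (c ≟ 0#)) ℕ.+ 1
      #A≤#nonzero+1 = ℕ.≤-trans (count-∪ (annihilates? v) (annihilates? v ∩? λ c → ¬? (c ≟ 0#)) (_≟ 0#) nonzero-or-0)
                                (ℕ.+-monoʳ-≤ _ (ℕ.≤-reflexive (count-unique (_≟ 0#) 0# refl (λ c≡0 → c≡0))))
        where
        nonzero-or-0 : ∀ {c} → Annihilates v c → (Annihilates v c × c ≢ 0#) ⊎ c ≡ 0#
        nonzero-or-0 {c} Ac with c ≟ 0#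
        ... | yes c≡0 = inj₂ c≡0
        ... | no  c≢0 = inj₁ (Ac , c≢0)
      #nonzero≢0 : count (annihilates? v ∩? λ c → ¬? (c ≟ 0#)) ≢ 0
      #nonzero≢0 #nonzero≡0 = contradiction (ℕ.≤-trans 2≤#A (subst (λ t → count (annihilates? v) ≤ t ℕ.+ 1) #nonzero≡0 #A≤#nonzero+1)) (λ { (s≤s ()) })

  -- Sums over cubes

  sumCube-cong : ∀ k {f g : (Fin k → Bool) → Carrier} → (∀ c → f c ≡ g c) → sumCube K k f ≡ sumCube K k g
  sumCube-cong zero    f≗g = f≗g _
  sumCube-cong (suc k) f≗g = cong₂ _+_ (sumCube-cong k (f≗g ∘ (false ∷_))) (sumCube-cong k (f≗g ∘ (true ∷_)))

  sumCube-+ : ∀ k (f g : (Fin k → Bool) → Carrier) → sumCube K k (λ c → f c + g c) ≡ sumCube K k f + sumCube K k g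
  sumCube-+ zero    f g = refl
  sumCube-+ (suc k) f g = trans (cong₂ _+_ (sumCube-+ k _ _) (sumCube-+ k _ _)) (+-interchange _ _ _ _)

  sumCube-*ˡ : ∀ k a (f : (Fin k → Bool) → Carrier) → sumCube K k (λ c → a * f c) ≡ a * sumCube K k f
  sumCube-*ˡ zero    a f = refl
  sumCube-*ˡ (suc k) a f = trans (cong₂ _+_ (sumCube-*ˡ k a _) (sumCube-*ˡ k a _)) (sym (distribˡ a _ _))

  sumCube-swap : ∀ k m (h : (Fin k → Bool) → (Fin m → Bool) → Carrier) →
                 sumCube K k (λ α → sumCube K m (h α)) ≡ sumCube K m (λ β → sumCube K k (λ α → h α β))
  sumCube-swap zero    m h = refl
  sumCube-swap (suc k) m h = trans (cong₂ _+_ (sumCube-swap k m _) (sumCube-swap k m _)) (sym (sumCube-+ m _ _))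

  sumCube-lin : ∀ k → 2 ≤ k → (w : Fin k → Carrier) → sumCube K k (λ α → lin K α w) ≡ 0#
  sumCube-lin (suc (suc k)) (s≤s (s≤s _)) w = begin
    sumCube K (suc k) (λ c → 0# + lin K c w′) + sumCube K (suc k) (λ c → w zero + lin K c w′)
      ≡⟨ cong₂ _+_ (sumCube-cong (suc k) (λ c → +-identityˡ (lin K c w′))) (sumCube-+ (suc k) (λ _ → w zero) (λ c → lin K c w′)) ⟩
    Σw′ + ((Σw₀ + Σw₀) + Σw′)           ≡⟨ cong (λ t → Σw′ + (t + Σw′)) (x+x≡0 Σw₀) ⟩
    Σw′ + (0# + Σw′)                    ≡⟨ cong (Σw′ +_) (+-identityˡ Σw′) ⟩
    Σw′ + Σw′                           ≡⟨ x+x≡0 Σw′ ⟩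
    0#                                  ∎
    where
    open ≡-Reasoning
    w′ = w ∘ suc
    Σw′ = sumCube K (suc k) (λ c → lin K c w′)
    Σw₀ = sumCube K k (λ _ → w zero)

  sumCube-++ : ∀ p m (e : Fin p → Carrier) (u : Fin m → Carrier) (g : Carrier → Carrier) →
               sumCube K (p ℕ.+ m) (λ γ → g (lin K γ (e ++ u))) ≡
               sumCube K p (λ α → sumCube K m (λ β → g (lin K α e + lin K β u)))
  sumCube-++ zero    m e u g = sumCube-cong m (λ β → cong g (sym (+-identityˡ _)))
  sumCube-++ (suc p) m e u g = cong₂ _+_ (half false) (half true)
    where
    half : ∀ b → sumCube K (p ℕ.+ m) (λ γ → g (lin K (b ∷ γ) (e ++ u))) ≡
                 sumCube K p (λ α → sumCube K m (λ β → g (lin K (b ∷ α) e + lin K β u)))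
    half b = begin
      sumCube K (p ℕ.+ m) (λ γ → g (lin K (b ∷ γ) (e ++ u)))
        ≡⟨ sumCube-cong (p ℕ.+ m) (λ γ → cong (λ t → g (_·_ K b (e zero) + t)) (lin-cong γ (++-suc e u))) ⟩
      sumCube K (p ℕ.+ m) (λ γ → g (_·_ K b (e zero) + lin K γ ((e ∘ suc) ++ u)))
        ≡⟨ sumCube-++ p m (e ∘ suc) u (λ t → g (_·_ K b (e zero) + t)) ⟩
      sumCube K p (λ α → sumCube K m (λ β → g (_·_ K b (e zero) + (lin K α (e ∘ suc) + lin K β u))))
        ≡⟨ sumCube-cong p (λ α → sumCube-cong m (λ β → cong g (sym (+-assoc _ _ _)))) ⟩
      sumCube K p (λ α → sumCube K m (λ β → g (lin K (b ∷ α) e + lin K β u)))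
        ∎
      where open ≡-Reasoning

  χ : ∀ {a} {A : Set a} → Dec A → Carrier
  χ (yes _) = 1#
  χ (no  _) = 0#

  χ-yes : ∀ {a} {A : Set a} (d : Dec A) → A → χ d ≡ 1#
  χ-yes (yes _) _ = refl
  χ-yes (no ¬a) a = contradiction a ¬a

  χ-no : ∀ {a} {A : Set a} (d : Dec A) → ¬ A → χ d ≡ 0#
  χ-no (yes a) ¬a = contradiction a ¬a
  χ-no (no  _) _  = refl

  χ-cong : ∀ {a b} {A : Set a} {B : Set b} (d : Dec A) (e : Dec B) → (A → B) → (B → A) → χ d ≡ χ e
  χ-cong (yes a) e A→B _ = sym (χ-yes e (A→B a))
  χ-cong (no ¬a) e _ B→A = sym (χ-no e (¬a ∘ B→A))

  χ-span-∷ : ∀ {k} (w : Fin (suc k) → Carrier) → Independent K w → ∀ x →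
             χ (L w x ≟ 0#) ≡ χ (L (w ∘ suc) x ≟ 0#) + χ (L (w ∘ suc) (x + w zero) ≟ 0#)
  χ-span-∷ w w-indep x with L (w ∘ suc) x ≟ 0# | L (w ∘ suc) (x + w zero) ≟ 0#
  ... | yes L′x≡0 | yes L′[x+w₀]≡0 = contradiction (begin
          L (w ∘ suc) (w zero)                           ≡⟨ cong (L (w ∘ suc)) (sym (x+[x+y]≡y x (w zero))) ⟩
          L (w ∘ suc) (x + (x + w zero))                 ≡⟨ L-additive (w ∘ suc) x (x + w zero) ⟩
          L (w ∘ suc) x + L (w ∘ suc) (x + w zero)       ≡⟨ cong₂ _+_ L′x≡0 L′[x+w₀]≡0 ⟩
          0# + 0#                                        ≡⟨ +-identityˡ 0# ⟩
          0#                                             ∎) (independent-head {w = w} w-indep)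
    where open ≡-Reasoning
  ... | yes L′x≡0 | no _ = trans (χ-yes (L w x ≟ 0#) (trans (cong (_* L (w ∘ suc) (x + w zero)) L′x≡0) (zeroˡ _))) (sym (+-identityʳ 1#))
  ... | no _ | yes L′[x+w₀]≡0 = trans (χ-yes (L w x ≟ 0#) (trans (cong (L (w ∘ suc) x *_) L′[x+w₀]≡0) (zeroʳ _))) (sym (+-identityˡ 1#))
  ... | no L′x≢0 | no L′[x+w₀]≢0 = trans (χ-no (L w x ≟ 0#) (*-nonzero L′x≢0 L′[x+w₀]≢0)) (sym (+-identityˡ 0#))

  sumCube-span : ∀ {k} (w : Fin k → Carrier) → Independent K w → (g : Carrier → Carrier) →
                 sumCube K k (λ α → g (lin K α w)) ≡ ∑ (λ x → χ (L w x ≟ 0#) * g x)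
  sumCube-span {zero} w _ g = sym (trans (∑-point _ 0# off-0) (trans (cong (_* g 0#) (χ-yes (0# ≟ 0#) refl)) (*-identityˡ _)))
    where
    off-0 : ∀ x → x ≢ 0# → χ (x ≟ 0#) * g x ≡ 0#
    off-0 x x≢0 = trans (cong (_* g x) (χ-no (x ≟ 0#) x≢0)) (zeroˡ (g x))
  sumCube-span {suc k} w w-indep g = begin
    sumCube K k (λ α → g (0# + lin K α w′)) + sumCube K k (λ α → g (w₀ + lin K α w′))
      ≡⟨ cong₂ _+_ (sumCube-span w′ w′-indep (λ z → g (0# + z))) (sumCube-span w′ w′-indep (λ z → g (w₀ + z))) ⟩
    ∑ (λ x → χ′ x * g (0# + x)) + ∑ (λ x → χ′ x * g (w₀ + x))
      ≡⟨ cong₂ _+_ (∑-cong (λ x → cong (λ t → χ′ x * g t) (+-identityˡ x))) (∑-translate w₀ (λ x → χ′ x * g (w₀ + x))) ⟩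
    ∑ (λ x → χ′ x * g x) + ∑ (λ x → χ′ (w₀ + x) * g (w₀ + (w₀ + x)))
      ≡⟨ cong (∑ (λ x → χ′ x * g x) +_) (∑-cong (λ x → cong₂ (λ s t → χ (L w′ s ≟ 0#) * g t) (+-comm w₀ x) (x+[x+y]≡y w₀ x))) ⟩
    ∑ (λ x → χ′ x * g x) + ∑ (λ x → χ′ (x + w₀) * g x)
      ≡⟨ sym (∑-distrib (λ x → χ′ x * g x) (λ x → χ′ (x + w₀) * g x)) ⟩
    ∑ (λ x → χ′ x * g x + χ′ (x + w₀) * g x)
      ≡⟨ ∑-cong (λ x → trans (sym (distribʳ (g x) _ _)) (cong (_* g x) (sym (χ-span-∷ w w-indep x)))) ⟩
    ∑ (λ x → χ (L w x ≟ 0#) * g x)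
      ∎
    where
    open ≡-Reasoning
    w₀ = w zero
    w′ = w ∘ suc
    w′-indep = independent-tail {w = w} w-indep
    χ′ : Carrier → Carrier
    χ′ x = χ (L w′ x ≟ 0#)

  -- Sums of inverses

  -- The product of the nonzero elements of span w.
  D : ∀ {k} → (Fin k → Carrier) → Carrier
  D {zero}  w = 1#
  D {suc k} w = D (w ∘ suc) * L (w ∘ suc) (w zero)

  D-nonzero : ∀ {k} {w : Fin k → Carrier} → Independent K w → D w ≢ 0#
  D-nonzero {zero}          _       = 0≢1 ∘ sym
  D-nonzero {suc k} {w = w} w-indep = *-nonzero (D-nonzero (independent-tail {w = w} w-indep)) (independent-head {w = w} w-indep)

  affineSum-translate : ∀ F {k} {w : Fin k → Carrier} → Independent K w → ∀ {y} → L w y ≡ 0# →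
                        affineSum K F k y w ≡ affineSum K F k 0# w
  affineSum-translate F {k} {w} w-indep {y} Ly≡0 = begin
    sumCube K k (λ α → F (y + lin K α w))           ≡⟨ sumCube-span w w-indep (λ x → F (y + x)) ⟩
    ∑ (λ x → χ (L w x ≟ 0#) * F (y + x))            ≡⟨ ∑-translate y (λ x → χ (L w x ≟ 0#) * F (y + x)) ⟩
    ∑ (λ x → χ (L w (y + x) ≟ 0#) * F (y + (y + x))) ≡⟨ ∑-cong (λ x → cong₂ _*_ (χ-cong (L w (y + x) ≟ 0#) (L w x ≟ 0#) (trans (sym (L[y+x]≡Lx x))) (trans (L[y+x]≡Lx x))) (cong F (x+[x+y]≡y y x))) ⟩
    ∑ (λ x → χ (L w x ≟ 0#) * F x)                   ≡⟨ ∑-cong (λ x → cong (λ t → χ (L w x ≟ 0#) * F t) (sym (+-identityˡ x))) ⟩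
    ∑ (λ x → χ (L w x ≟ 0#) * F (0# + x))            ≡⟨ sym (sumCube-span w w-indep (λ x → F (0# + x))) ⟩
    sumCube K k (λ α → F (0# + lin K α w))           ∎
    where
    open ≡-Reasoning
    L[y+x]≡Lx : ∀ x → L w (y + x) ≡ L w x
    L[y+x]≡Lx x = trans (L-additive w y x) (trans (cong (_+ L w x) Ly≡0) (+-identityˡ (L w x)))

  -- For n = 1, Finv x = x ^ 0 = 1 is not an inversion.
  module _ (2≤n : 2 ≤ n) where

    Finv≡^ : ∀ x → Finv K x ≡ x ^ (N ℕ.∸ 2)
    Finv≡^ x = pow≡^ (N ℕ.∸ 2)
      where
      pow≡^ : ∀ m → pow K x m ≡ x ^ m
      pow≡^ zero    = refl
      pow≡^ (suc m) = cong (x *_) (pow≡^ m)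

    private
      4≤N : 4 ≤ N
      4≤N = ℕ.^-monoʳ-≤ 2 2≤n

      N∸1≡1+[N∸2] : N ℕ.∸ 1 ≡ suc (N ℕ.∸ 2)
      N∸1≡1+[N∸2] = ℕ.+-∸-assoc 1 (ℕ.≤-trans (s≤s (s≤s z≤n)) 4≤N)

      N∸2≡1+[N∸3] : N ℕ.∸ 2 ≡ suc (N ℕ.∸ 3)
      N∸2≡1+[N∸3] = ℕ.+-∸-assoc 1 (ℕ.≤-trans (s≤s (s≤s (s≤s z≤n))) 4≤N)

    Finv-inverse : ∀ {x} → x ≢ 0# → Finv K x * x ≡ 1#
    Finv-inverse {x} x≢0 = begin
      Finv K x * x               ≡⟨ cong (_* x) (Finv≡^ x) ⟩
      x ^ (N ℕ.∸ 2) * x          ≡⟨ *-comm _ x ⟩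
      x ^ suc (N ℕ.∸ 2)          ≡⟨ cong (x ^_) (sym N∸1≡1+[N∸2]) ⟩
      x ^ (N ℕ.∸ 1)              ≡⟨ x^[N∸1]≡1 x≢0 ⟩
      1#                         ∎
      where open ≡-Reasoning

    Finv-0# : Finv K 0# ≡ 0#
    Finv-0# = trans (Finv≡^ 0#) (trans (cong (0# ^_) N∸2≡1+[N∸3]) (zeroˡ _))

    Finv-unique : ∀ {x y} → x * y ≡ 1# → Finv K x ≡ y
    Finv-unique {x} {y} xy≡1 = begin
      Finv K x                   ≡⟨ sym (*-identityʳ _) ⟩
      Finv K x * 1#              ≡⟨ cong (Finv K x *_) (sym xy≡1) ⟩
      Finv K x * (x * y)         ≡⟨ sym (*-assoc _ x y) ⟩
      (Finv K x * x) * y         ≡⟨ cong (_* y) (Finv-inverse x≢0) ⟩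
      1# * y                     ≡⟨ *-identityˡ y ⟩
      y                          ∎
      where
      open ≡-Reasoning
      x≢0 : x ≢ 0#
      x≢0 x≡0 = 0≢1 (trans (sym (zeroˡ y)) (trans (cong (_* y) (sym x≡0)) xy≡1))

    Finv-involutive : ∀ x → Finv K (Finv K x) ≡ x
    Finv-involutive x with x ≟ 0#
    ... | yes refl = trans (cong (Finv K) Finv-0#) Finv-0#
    ... | no  x≢0  = Finv-unique (Finv-inverse x≢0)

    Finv-* : ∀ x y → Finv K (x * y) ≡ Finv K x * Finv K y
    Finv-* x y = trans (Finv≡^ (x * y)) (trans (^-distrib-* x y (N ℕ.∸ 2)) (sym (cong₂ _*_ (Finv≡^ x) (Finv≡^ y))))

    Finv-frobenius : ∀ k x → frobenius k (Finv K x) ≡ Finv K (frobenius k x)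
    Finv-frobenius k x = trans (cong (frobenius k) (Finv≡^ x)) (trans (frobenius-^ k x (N ℕ.∸ 2)) (sym (Finv≡^ _)))

    Finv-involution : Carrier ↔ Carrier
    Finv-involution = mk↔ₛ′ (Finv K) (Finv K) Finv-involutive Finv-involutive

    affineSum-Finv-* : ∀ {k} {w : Fin k → Carrier} → Independent K w → ∀ {y} → L w y ≢ 0# →
                       affineSum K (Finv K) k y w * L w y ≡ D w
    affineSum-Finv-* {zero} _ {y} y≢0 = trans (cong (λ t → Finv K t * y) (+-identityʳ y)) (Finv-inverse y≢0)
    affineSum-Finv-* {suc k} {w} w-indep {y} Ly≢0 = begin
      (sumCube K k (λ c → Finv K (y + (0# + lin K c w′))) + sumCube K k (λ c → Finv K (y + (w₀ + lin K c w′)))) * (A * B)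
        ≡⟨ cong (_* (A * B)) (cong₂ _+_ (sumCube-cong k (λ c → cong (λ t → Finv K (y + t)) (+-identityˡ _)))
                                        (sumCube-cong k (λ c → cong (Finv K) (sym (+-assoc y w₀ _))))) ⟩
      (S′ y + S′ (y + w₀)) * (A * B)                ≡⟨ distribʳ (A * B) (S′ y) (S′ (y + w₀)) ⟩
      S′ y * (A * B) + S′ (y + w₀) * (A * B)        ≡⟨ cong₂ _+_ (sym (*-assoc (S′ y) A B)) (trans (cong (S′ (y + w₀) *_) (*-comm A B)) (sym (*-assoc (S′ (y + w₀)) B A))) ⟩
      (S′ y * A) * B + (S′ (y + w₀) * B) * A        ≡⟨ cong₂ _+_ (cong (_* B) (affineSum-Finv-* w′-indep A≢0)) (cong (_* A) (affineSum-Finv-* w′-indep B≢0)) ⟩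
      D w′ * B + D w′ * A                           ≡⟨ sym (distribˡ (D w′) B A) ⟩
      D w′ * (B + A)                                ≡⟨ cong (D w′ *_) B+A≡L′w₀ ⟩
      D w′ * L w′ w₀                                ∎
      where
      open ≡-Reasoning
      w₀ = w zero
      w′ = w ∘ suc
      w′-indep = independent-tail {w = w} w-indep
      A = L w′ y
      B = L w′ (y + w₀)
      S′ : Carrier → Carrier
      S′ z = affineSum K (Finv K) k z w′
      A≢0 : A ≢ 0#
      A≢0 A≡0 = Ly≢0 (trans (cong (_* B) A≡0) (zeroˡ B))
      B≢0 : B ≢ 0#
      B≢0 B≡0 = Ly≢0 (trans (cong (A *_) B≡0) (zeroʳ A))
      B+A≡L′w₀ : B + A ≡ L w′ w₀
      B+A≡L′w₀ = trans (cong (_+ A) (L-additive w′ y w₀)) (trans (cong (_+ A) (+-comm A _)) ([x+y]+y≡x _ A))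

    affineSum-Finv≡0⇒∈span : ∀ {k} {a} {v : Fin k → Carrier} → Independent K v → affineSum K (Finv K) k a v ≡ 0# → L v a ≡ 0#
    affineSum-Finv≡0⇒∈span {k} {a} {v} v-indep sum≡0 with L v a ≟ 0#
    ... | yes La≡0 = La≡0
    ... | no  La≢0 = contradiction (trans (sym (affineSum-Finv-* v-indep La≢0)) (trans (cong (_* L v a) sum≡0) (zeroˡ _)))
                                   (D-nonzero v-indep)

    affineSum-Finv : ∀ {k} {w : Fin k → Carrier} → Independent K w → affineSum K (Finv K) k 0# w ≡ 0# →
                     ∀ y → affineSum K (Finv K) k y w ≡ D w * Finv K (L w y)
    affineSum-Finv {k} {w} w-indep span-sum≡0 y with L w y ≟ 0#
    ... | yes Ly≡0 = begin
      affineSum K (Finv K) k y w      ≡⟨ affineSum-translate (Finv K) w-indep Ly≡0 ⟩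
      affineSum K (Finv K) k 0# w     ≡⟨ span-sum≡0 ⟩
      0#                              ≡⟨ sym (zeroʳ (D w)) ⟩
      D w * 0#                        ≡⟨ cong (D w *_) (sym (trans (cong (Finv K) Ly≡0) Finv-0#)) ⟩
      D w * Finv K (L w y)            ∎
      where open ≡-Reasoning
    ... | no  Ly≢0 = begin
      S                                ≡⟨ sym (*-identityʳ S) ⟩
      S * 1#                           ≡⟨ cong (S *_) (sym (trans (*-comm (L w y) _) (Finv-inverse Ly≢0))) ⟩
      S * (L w y * Finv K (L w y))     ≡⟨ sym (*-assoc S _ _) ⟩
      (S * L w y) * Finv K (L w y)     ≡⟨ cong (_* Finv K (L w y)) (affineSum-Finv-* w-indep Ly≢0) ⟩
      D w * Finv K (L w y)             ∎
      where
      open ≡-Reasoning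
      S = affineSum K (Finv K) k y w

    module Subfield (l m : ℕ) (2≤l : 2 ≤ l) (n≡[1+m]l : n ≡ suc m ℕ.* l) where

      InE : Pred Carrier 0ℓ
      InE x = frobenius l x ≡ x

      inE? : Decidable InE
      inE? x = frobenius l x ≟ x

      E-isSubgroup : IsSubgroup InE
      E-isSubgroup = record
        { 0#-closed = frobenius-0# l
        ; +-closed  = λ {x} {y} x∈E y∈E → trans (frobenius-+ l x y) (cong₂ _+_ x∈E y∈E) }

      E-Finv-closed : ∀ {x} → InE x → InE (Finv K x)
      E-Finv-closed {x} x∈E = trans (Finv-frobenius l x) (cong (Finv K) x∈E)

      count-E≤2ˡ : count inE? ≤ 2 ℕ.^ l
      count-E≤2ˡ = ℕ.≤-trans (ℕ.≤-reflexive (count-cong inE? (λ x → frobenius l x + x ≟ 0#) x≡y⇒x+y≡0 x+y≡0⇒x≡y))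
                             (root-bound (2 ℕ.^ l) φ-monic)
        where
        x≡y⇒x+y≡0 : ∀ {x y} → x ≡ y → x + y ≡ 0#
        x≡y⇒x+y≡0 {x} refl = x+x≡0 x
        φ-monic : Monic (2 ℕ.^ l) (λ x → frobenius l x + x)
        φ-monic = (_^ 1) , Poly<-^ (ℕ.^-monoʳ-< 2 (s≤s (s≤s z≤n)) (ℕ.≤-trans (s≤s z≤n) 2≤l)) ,
                  (λ x → cong (frobenius l x +_) (sym (*-identityʳ x)))

      partialTrace : ℕ → Carrier → Carrier
      partialTrace zero    x = 0#
      partialTrace (suc j) x = partialTrace j x + frobenius (l ℕ.* j) x

      partialTrace-additive : ∀ j → Additive (partialTrace j)
      partialTrace-additive zero    x y = sym (+-identityˡ 0#)
      partialTrace-additive (suc j) x y =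
        trans (cong₂ _+_ (partialTrace-additive j x y) (frobenius-+ (l ℕ.* j) x y)) (+-interchange _ _ _ _)

      frobenius-partialTrace : ∀ j x → frobenius l (partialTrace j x) ≡ partialTrace (suc j) x + x
      frobenius-partialTrace zero x = begin
        frobenius l 0#                         ≡⟨ frobenius-0# l ⟩
        0#                                     ≡⟨ sym (x+x≡0 x) ⟩
        x + x                                  ≡⟨ cong (_+ x) (sym (trans (+-identityˡ _) (trans (cong (λ k → frobenius k x) (ℕ.*-zeroʳ l)) (*-identityʳ x)))) ⟩
        (0# + frobenius (l ℕ.* 0) x) + x       ∎
        where open ≡-Reasoning
      frobenius-partialTrace (suc j) x = begin
        frobenius l (partialTrace j x + frobenius (l ℕ.* j) x)                ≡⟨ frobenius-+ l _ _ ⟩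
        frobenius l (partialTrace j x) + frobenius l (frobenius (l ℕ.* j) x)  ≡⟨ cong₂ _+_ (frobenius-partialTrace j x) (frobenius-∘ l (l ℕ.* j) x) ⟩
        (partialTrace (suc j) x + x) + frobenius (l ℕ.+ l ℕ.* j) x            ≡⟨ cong (λ k → (partialTrace (suc j) x + x) + frobenius k x) (sym (ℕ.*-suc l j)) ⟩
        (partialTrace (suc j) x + x) + frobenius (l ℕ.* suc j) x              ≡⟨ +-assoc _ x _ ⟩
        partialTrace (suc j) x + (x + frobenius (l ℕ.* suc j) x)              ≡⟨ cong (partialTrace (suc j) x +_) (+-comm x _) ⟩
        partialTrace (suc j) x + (frobenius (l ℕ.* suc j) x + x)              ≡⟨ sym (+-assoc _ _ x) ⟩
        partialTrace (suc (suc j)) x + x                                      ∎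
        where open ≡-Reasoning

      trace : Carrier → Carrier
      trace = partialTrace (suc m)

      l[1+m]≡n : l ℕ.* suc m ≡ n
      l[1+m]≡n = trans (ℕ.*-comm l (suc m)) (sym n≡[1+m]l)

      trace∈E : ∀ x → InE (trace x)
      trace∈E x = begin
        frobenius l (trace x)                                  ≡⟨ frobenius-partialTrace (suc m) x ⟩
        (trace x + frobenius (l ℕ.* suc m) x) + x              ≡⟨ cong (λ k → (trace x + frobenius k x) + x) l[1+m]≡n ⟩
        (trace x + frobenius n x) + x                          ≡⟨ cong (λ t → (trace x + t) + x) (frobenius-n x) ⟩
        (trace x + x) + x                                      ≡⟨ [x+y]+y≡x (trace x) x ⟩
        trace x                                                ∎
        where open ≡-Reasoning

      partialTrace-Poly< : ∀ j → Poly< (2 ℕ.^ (l ℕ.* j)) (partialTrace j)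
      partialTrace-Poly< zero    = Poly<-0 _
      partialTrace-Poly< (suc j) = Poly<-+ (Poly<-≤ (ℕ.<⇒≤ 2ˡʲ<2ˡ⁽ʲ⁺¹⁾) (partialTrace-Poly< j)) (Poly<-^ 2ˡʲ<2ˡ⁽ʲ⁺¹⁾)
        where
        2ˡʲ<2ˡ⁽ʲ⁺¹⁾ : 2 ℕ.^ (l ℕ.* j) < 2 ℕ.^ (l ℕ.* suc j)
        2ˡʲ<2ˡ⁽ʲ⁺¹⁾ = ℕ.^-monoʳ-< 2 (s≤s (s≤s z≤n))
                        (subst (l ℕ.* j <_) (sym (ℕ.*-suc l j)) (ℕ.m<n+m (l ℕ.* j) (ℕ.≤-trans (s≤s z≤n) 2≤l)))

      trace-monic : Monic (2 ℕ.^ (l ℕ.* m)) trace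
      trace-monic = partialTrace m , partialTrace-Poly< m , (λ x → +-comm _ _)

      2ˡᵐ*2ˡ≡N : 2 ℕ.^ (l ℕ.* m) ℕ.* 2 ℕ.^ l ≡ N
      2ˡᵐ*2ˡ≡N = trans (sym (ℕ.^-distribˡ-+-* 2 (l ℕ.* m) l))
                       (cong (2 ℕ.^_) (trans (ℕ.+-comm (l ℕ.* m) l) (trans (sym (ℕ.*-suc l m)) l[1+m]≡n)))

      2ˡ≤count-E : 2 ℕ.^ l ≤ count inE?
      2ˡ≤count-E = ℕ.*-cancelˡ-≤ (2 ℕ.^ (l ℕ.* m)) {{ℕ.m^n≢0 2 (l ℕ.* m)}} (begin
        2 ℕ.^ (l ℕ.* m) ℕ.* 2 ℕ.^ l                                      ≡⟨ 2ˡᵐ*2ˡ≡N ⟩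
        N                                                                ≡⟨ sym count-U ⟩
        count U?                                                         ≡⟨ rank-nullity U? U-isSubgroup (partialTrace-additive (suc m)) ⟩
        count (U? ∩? λ x → trace x ≟ 0#) ℕ.* count (image? U? trace)     ≤⟨ ℕ.*-mono-≤ kernel-bound image⊆E ⟩
        2 ℕ.^ (l ℕ.* m) ℕ.* count inE?                                   ∎)
        where
        open ℕ.≤-Reasoning
        kernel-bound : count (U? ∩? λ x → trace x ≟ 0#) ≤ 2 ℕ.^ (l ℕ.* m)
        kernel-bound = ℕ.≤-trans (count-mono (U? ∩? λ x → trace x ≟ 0#) (λ x → trace x ≟ 0#) proj₂) (root-bound _ trace-monic)
        image⊆E : count (image? U? trace) ≤ count inE?
        image⊆E = count-mono (image? U? trace) inE? (λ { (x , _ , trace-x≡y) → subst InE trace-x≡y (trace∈E x) })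

      count-E : count inE? ≡ 2 ℕ.^ l
      count-E = ℕ.≤-antisym count-E≤2ˡ 2ˡ≤count-E

      E-basis : ∃[ e ] Basis InE {l} e
      E-basis with basis inE? E-isSubgroup
      ... | k , e , e-basis with 2^-injective {k} {l} (trans (sym (basis-count inE? e-basis)) count-E)
      ...   | refl = e , e-basis

      e : Fin l → Carrier
      e = proj₁ E-basis

      e-independent : Independent K e
      e-independent = proj₁ (proj₂ E-basis)

      E⊆span : ∀ {x} → InE x → L e x ≡ 0#
      E⊆span = proj₁ (proj₂ (proj₂ E-basis))

      span⊆E : ∀ {x} → L e x ≡ 0# → InE x
      span⊆E = proj₂ (proj₂ (proj₂ E-basis))

      ∑E-Finv≡0 : affineSum K (Finv K) l 0# e ≡ 0#
      ∑E-Finv≡0 = begin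
        sumCube K l (λ α → Finv K (0# + lin K α e))           ≡⟨ sumCube-span e e-independent (λ x → Finv K (0# + x)) ⟩
        ∑ (λ x → χ (L e x ≟ 0#) * Finv K (0# + x))             ≡⟨ ∑-cong (λ x → cong (λ t → χ (L e x ≟ 0#) * Finv K t) (+-identityˡ x)) ⟩
        ∑ (λ x → χ (L e x ≟ 0#) * Finv K x)                    ≡⟨ ∑-reindex Finv-involution (λ x → χ (L e x ≟ 0#) * Finv K x) ⟩
        ∑ (λ x → χ (L e (Finv K x) ≟ 0#) * Finv K (Finv K x))  ≡⟨ ∑-cong (λ x → cong₂ _*_ (χ-Finv x) (Finv-involutive x)) ⟩
        ∑ (λ x → χ (L e x ≟ 0#) * x)                           ≡⟨ sym (sumCube-span e e-independent (λ x → x)) ⟩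
        sumCube K l (λ α → lin K α e)                          ≡⟨ sumCube-lin l 2≤l e ⟩
        0#                                                     ∎
        where
        open ≡-Reasoning
        χ-Finv : ∀ x → χ (L e (Finv K x) ≟ 0#) ≡ χ (L e x ≟ 0#)
        χ-Finv x = χ-cong (L e (Finv K x) ≟ 0#) (L e x ≟ 0#)
          (λ Lx⁻¹≡0 → E⊆span (subst InE (Finv-involutive x) (E-Finv-closed (span⊆E Lx⁻¹≡0))))
          (λ Lx≡0 → E⊆span (E-Finv-closed (span⊆E Lx≡0)))

      affineSum-E : ∀ y → affineSum K (Finv K) l y e ≡ D e * Finv K (L e y)
      affineSum-E = affineSum-Finv e-independent ∑E-Finv≡0

      module Lift {r} (rl<n : r ℕ.* l < n) {a : Carrier} {v : Fin r → Carrier}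
                  (v-indep : Independent K v) (sum≡0 : affineSum K (Finv K) r a v ≡ 0#) where

        cokernel-L : ∃[ h ] (Additive h × (∀ {y} → h y ≡ 0# → Image U (L e) y) × count (image? U? h) ≡ count (λ x → L e x ≟ 0#))
        cokernel-L = cokernel (L-additive e)

        h : Carrier → Carrier
        h = proj₁ cokernel-L

        h-additive : Additive h
        h-additive = proj₁ (proj₂ cokernel-L)

        #im-h≤2ˡ : count (image? U? h) ≤ 2 ℕ.^ l
        #im-h≤2ˡ = ℕ.≤-reflexive (trans (proj₂ (proj₂ (proj₂ cokernel-L))) (count-span e e-independent))

        multiplier : ∃[ c ] (c ≢ 0# × Annihilates {h} h-additive v c)
        multiplier = nonzero-annihilator {h} h-additive {l} #im-h≤2ˡ {r} v rl<n

        c : Carrier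
        c = proj₁ multiplier

        c≢0 : c ≢ 0#
        c≢0 = proj₁ (proj₂ multiplier)

        cv∈L[K] : ∀ i → Image U (L e) (c * v i)
        cv∈L[K] i = proj₁ (proj₂ (proj₂ cokernel-L)) (proj₂ (proj₂ multiplier) i)

        u : Fin r → Carrier
        u i = proj₁ (cv∈L[K] i)

        L-lin-u : ∀ β → L e (lin K β u) ≡ c * lin K β v
        L-lin-u β = trans (lin-additive (L-additive e) β u)
                          (trans (lin-cong β (λ i → proj₂ (proj₂ (cv∈L[K] i)))) (sym (lin-*ˡ c β v)))

        a∈span-v : ∃[ c₀ ] lin K c₀ v ≡ a
        a∈span-v = L≡0⇒∈span v (affineSum-Finv≡0⇒∈span v-indep sum≡0)

        a′ : Carrier
        a′ = lin K (proj₁ a∈span-v) u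

        L-shift : ∀ β → L e (a′ + lin K β u) ≡ c * (a + lin K β v)
        L-shift β = trans (L-additive e a′ _) (trans (cong₂ _+_ (L-lin-u _) (L-lin-u β))
                      (trans (sym (distribˡ c _ _)) (cong (λ t → c * (t + lin K β v)) (proj₂ a∈span-v))))

        w : Fin (l ℕ.+ r) → Carrier
        w = e ++ u

        w-independent : Independent K w
        w-independent = independent-++ (L-additive e) e-independent (L-generator e)
                          (independent-cong (λ i → sym (proj₂ (proj₂ (cv∈L[K] i)))) (independent-*ˡ c≢0 v-indep))

        sum′≡0 : affineSum K (Finv K) (l ℕ.+ r) a′ w ≡ 0#
        sum′≡0 = begin
          sumCube K (l ℕ.+ r) (λ γ → Finv K (a′ + lin K γ (e ++ u)))
            ≡⟨ sumCube-++ l r e u (λ t → Finv K (a′ + t)) ⟩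
          sumCube K l (λ α → sumCube K r (λ β → Finv K (a′ + (lin K α e + lin K β u))))
            ≡⟨ sumCube-swap l r _ ⟩
          sumCube K r (λ β → sumCube K l (λ α → Finv K (a′ + (lin K α e + lin K β u))))
            ≡⟨ sumCube-cong r (λ β → sumCube-cong l (λ α → cong (Finv K) (regroup (lin K α e) (lin K β u)))) ⟩
          sumCube K r (λ β → affineSum K (Finv K) l (a′ + lin K β u) e)
            ≡⟨ sumCube-cong r (λ β → trans (affineSum-E _) (cong (λ t → D e * Finv K t) (L-shift β))) ⟩
          sumCube K r (λ β → D e * Finv K (c * (a + lin K β v)))
            ≡⟨ sumCube-cong r (λ β → cong (D e *_) (Finv-* c _)) ⟩
          sumCube K r (λ β → D e * (Finv K c * Finv K (a + lin K β v)))
            ≡⟨ trans (sumCube-*ˡ r (D e) _) (cong (D e *_) (sumCube-*ˡ r (Finv K c) _)) ⟩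
          D e * (Finv K c * affineSum K (Finv K) r a v)
            ≡⟨ cong (λ t → D e * (Finv K c * t)) sum≡0 ⟩
          D e * (Finv K c * 0#)
            ≡⟨ trans (cong (D e *_) (zeroʳ _)) (zeroʳ _) ⟩
          0#
            ∎
          where
          open ≡-Reasoning
          regroup : ∀ x y → a′ + (x + y) ≡ (a′ + y) + x
          regroup x y = trans (cong (a′ +_) (+-comm x y)) (sym (+-assoc a′ y x))

-- Opened only here: inside Field they would clash with the field operations.
open import Data.Nat using (_+_; _*_)
open import Data.Nat.Divisibility using (_∣_; divides)

corollary5p1 : (n l r : ℕ) → 1 ≤ n → 2 ≤ l → 1 ≤ r → l ∣ n → r * l < n →
    (K : FiniteField2^ n) →
    ¬ SumFree K r (Finv K) → ¬ SumFree K (l + r) (Finv K)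
-- The hypothesis 1 ≤ n is implied by 2 ≤ l ≤ r * l < n.
corollary5p1 _ l r _ 2≤l 1≤r (divides zero refl) ()
corollary5p1 n l r _ 2≤l 1≤r (divides (suc m) n≡[1+m]l) rl<n K r-not-sum-free l+r-sum-free = r-not-sum-free r-sum-free
  where
  2≤n : 2 ≤ n
  2≤n = ℕ.≤-trans 2≤l (ℕ.≤-trans (ℕ.m≤n*m l r {{ℕ.>-nonZero 1≤r}}) (ℕ.<⇒≤ rl<n))

  r-sum-free : SumFree K r (Finv K)
  r-sum-free a v v-indep sum≡0 = l+r-sum-free a′ w w-independent sum′≡0
    where open Field.Subfield.Lift K 2≤n l m 2≤l n≡[1+m]l rl<n v-indep sum≡0
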